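{- Let $\alpha=(0^{i_1},s_1,\ldots,0^{i_k},s_k)$ be a left weak composition with $i_p\geq0$, $s_p\geq1$. Then $$F_\alpha=\sum_{\beta\preceq\alpha}c_{\alpha,\beta}M_\beta,$$ where for $\beta=(0^{j_1},\beta_1,\ldots,0^{j_k},\beta_k)\preceq\alpha$ (with $\beta_p$ a composition of $s_p$ and $0\leq j_p\leq i_p$) one sets $c_{\alpha,\beta}=\binom{i_1}{j_1}\cdots\binom{i_k}{j_k}$; in particular $c_{\alpha,\alpha}=1$. Moreover, the elements $F_\alpha$, as $\alpha$ runs through all left weak compositions, together with $F_\emptyset=1$, form a $\mathbb{Q}$-basis of $\mathrm{LWCQSym}$.
   Context: Coefficients are in $\mathbb{Q}$; $x_1,x_2,\ldots$ are commuting variables; $0^i$ denotes $i$ zero entries. A left weak composition is a finite nonempty sequence of nonnegative integers whose last entry is positive; a composition of $s$ is a nonempty finite sequence of positive integers summing to $s$. For a left weak composition $\gamma=(\gamma_1,\ldots,\gamma_r)$, $M_\gamma=\sum_{1\leq n_1<\cdots<n_r}x_{n_1}^{\gamma_1}\cdots x_{n_r}^{\gamma_r}$. $\mathrm{LWCQSym}$ is the $\mathbb{Q}$-span of $1$ and all $M_\gamma$. Partial order: for left weak compositions $\alpha=(0^{i_1},s_1,\ldots,0^{i_k},s_k)$ ($s_p\geq1$) and $\beta$ of the same size, $\beta\preceq\alpha$ iff $\beta$ can be written as $(0^{j_1},\beta_1,\ldots,0^{j_k},\beta_k)$ where $0\leq j_p\leq i_p$ and $\beta_p$ is a composition of $s_p$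 for each $p$ (the $\beta_p$ written out as consecutive entries). With $a_p=i_1+s_1+\cdots+i_p+s_p$ ($a_0=0$), the LWC fundamental quasi-symmetric function is $$F_\alpha=\sum x_{n_1}^0\cdots x_{n_{i_1}}^0x_{n_{i_1+1}}\cdots x_{n_{a_1}}\cdots x_{n_{a_{k-1}+1}}^0\cdots x_{n_{a_{k-1}+i_k}}^0x_{n_{a_{k-1}+i_k+1}}\cdots x_{n_{a_k}},$$ summed over $1\leq n_1\leq\cdots\leq n_{a_1}<n_{a_1+1}\leq\cdots<n_{a_{k-1}+1}\leq\cdots\leq n_{a_k}$ (weak inequalities everywhere except strict at positions $a_1,\ldots,a_{k-1}$). -}

module Defs where

open import Data.Bool using (Bool; true; false; _∧_; if_then_else_)
open import Data.Nat using (ℕ; zero; suc; _<ᵇ_; _≤ᵇ_; _≡ᵇ_; _≤_; _<_)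
open import Data.Nat.Combinatorics using (_C_)
open import Data.List using (List; []; _∷_; _++_; map; concat; concatMap; replicate;
  length; zipWith; upTo; filterᵇ; foldr)
open import Data.Nat.ListAction using (sum)
import Data.List as L
open import Data.List.NonEmpty using (List⁺; toList)
open import Data.List.Relation.Binary.Pointwise using (Pointwise)
open import Data.List.Relation.Unary.All using (All)
open import Data.List.Properties using (≡-dec)
open import Data.Product using (_×_; _,_; proj₁; proj₂; ∃; Σ)
open import Data.Integer using (+_)
open import Data.Rational using (ℚ; 0ℚ; 1ℚ; _/_) renaming (_+_ to _+ℚ_; _*_ to _*ℚ_)
open import Relation.Binary.PropositionalEquality using (_≡_)
open import Relation.Nullary.Decidable using (isYes)
import Data.Nat as N

-- Formal power series in x₁, x₂, … with ℚ coefficients.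
-- A monomial x₁^e₁ ⋯ x_L^e_L is encoded by its exponent list (e₁,…,e_L)
-- (trailing zeros are harmless: all series below give the same coefficient
-- to e and e ++ [0,…,0]).

Monomial : Set
Monomial = List ℕ

Series : Set
Series = Monomial → ℚ

_≋_ : Series → Series → Set
f ≋ g = ∀ e → f e ≡ g e

infix 4 _≋_

ℕ→ℚ : ℕ → ℚ
ℕ→ℚ n = + n / 1

0S : Series
0S _ = 0ℚ

allZero : List ℕ → Bool
allZero []       = true
allZero (x ∷ xs) = (x N.≡ᵇ 0) ∧ allZero xs

1S : Series
1S e = if allZero e then 1ℚ else 0ℚ

_⊕_ : Series → Series → Series
(f ⊕ g) e = f e +ℚ g e

_•_ : ℚ → Series → Series
(c • f) e = c *ℚ f e

infixl 6 _⊕_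
infixl 7 _•_

ΣS : {A : Set} → List A → (A → Series) → Series
ΣS []       f = 0S
ΣS (a ∷ as) f = f a ⊕ ΣS as f

-- A pattern is a list of (flag, exponent) pairs (b₁,g₁),…,(b_r,g_r); it denotes
--   Σ x_{n₁}^{g₁} ⋯ x_{n_r}^{g_r}
-- over 1 ≤ n₁ ,…, n_r with n_{j-1} < n_j if b_j = true and n_{j-1} ≤ n_j if
-- b_j = false (b₁ is ignored).  When the last exponent is positive, only
-- index tuples with all n_j ≤ length e can produce the monomial e, so the
-- coefficient of e is a finite count over [1..L]^r, L = length e.

tuples : ℕ → ℕ → List (List ℕ)
tuples L zero    = [] ∷ []
tuples L (suc r) = concatMap (λ n → map (n ∷_) (tuples L r)) (map suc (upTo L))

chainOK : List (Bool × ℕ) → List ℕ → Bool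
chainOK (_ ∷ (b , _) ∷ pat) (n ∷ m ∷ ns) =
  (if b then n <ᵇ m else n ≤ᵇ m) ∧ chainOK ((b , 0) ∷ pat) (m ∷ ns)
chainOK _ _ = true

expo : ℕ → List (Bool × ℕ) → List ℕ → List ℕ
expo L pat ns =
  map (λ n → sum (zipWith (λ bg m → if m ≡ᵇ n then proj₂ bg else 0) pat ns))
      (map suc (upTo L))

coefPat : List (Bool × ℕ) → Monomial → ℕ
coefPat pat e =
  length (filterᵇ (λ ns → chainOK pat ns ∧ isYes (≡-dec N._≟_ (expo (length e) pat ns) e))
                  (tuples (length e) (length pat)))

seriesPat : List (Bool × ℕ) → Series
seriesPat pat e = ℕ→ℚ (coefPat pat e)

-- Left weak compositions, in block form:
-- a block (i , t) stands for 0^i followed by the positive entry suc t, so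
-- (0^{i₁}, s₁, …, 0^{i_k}, s_k) is the nonempty list of blocks (i_p , s_p - 1).
-- This is a bijection with left weak compositions (nonempty, last entry > 0).

LWC : Set
LWC = List⁺ (ℕ × ℕ)

flat : LWC → List ℕ
flat α = concatMap (λ b → replicate (proj₁ b) 0 ++ (suc (proj₂ b) ∷ [])) (toList α)

Mseq : List ℕ → Series
Mseq γ = seriesPat (map (true ,_) γ)

M : LWC → Series
M α = Mseq (flat α)

-- pattern of F_α: block p contributes i_p zeros then s_p ones; the index
-- inequality is strict exactly at the first position of each block p ≥ 2
-- (i.e. between positions a_{p-1} and a_{p-1}+1), weak elsewhere.
blockPat : Bool → ℕ × ℕ → List (Bool × ℕ)
blockPat b (i , t) = L.zip (b ∷ replicate (i N.+ t) false) (replicate i 0 ++ replicate (suc t) 1)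

Fpat : List (ℕ × ℕ) → List (Bool × ℕ)
Fpat []       = []
Fpat (x ∷ xs) = blockPat false x ++ concatMap (blockPat true) xs

F : LWC → Series
F α = seriesPat (Fpat (toList α))

-- β ⪯ α via decompositions β = (0^{j₁}, β₁, …, 0^{j_k}, β_k):
-- a decomposition is a list of pairs (j_p , β_p).

Decomp : Set
Decomp = List (ℕ × List ℕ)

IsComposition : ℕ → List ℕ → Set
IsComposition s c = All (0 <_) c × sum c ≡ s

BlockOK : ℕ × ℕ → ℕ × List ℕ → Set
BlockOK (i , t) (j , c) = j ≤ i × IsComposition (suc t) c

ValidDecomp : LWC → Decomp → Set
ValidDecomp α d = Pointwise BlockOK (toList α) d

βOf : Decomp → List ℕ
βOf d = concatMap (λ jc → replicate (proj₁ jc) 0 ++ proj₂ jc) d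

_⪯_ : List ℕ → LWC → Set
β ⪯ α = ∃ λ d → ValidDecomp α d × βOf d ≡ β

cOf : LWC → Decomp → ℚ
cOf α d = foldr _*ℚ_ 1ℚ (zipWith (λ it jc → ℕ→ℚ (proj₁ it C proj₁ jc)) (toList α) d)

lin : (LWC → Series) → List (ℚ × LWC) → Series
lin G cs = ΣS cs (λ cα → proj₁ cα • G (proj₂ cα))

InLWCQSym : Series → Set
InLWCQSym f = Σ ℚ λ c₀ → Σ (List (ℚ × LWC)) λ cs → f ≋ c₀ • 1S ⊕ lin M cs

InSpanF : Series → Set
InSpanF f = Σ ℚ λ c₀ → Σ (List (ℚ × LWC)) λ cs → f ≋ c₀ • 1S ⊕ lin F cs

-- Every series here is a pattern series: a sum of monomials x_{n₁}^{g₁} ⋯ x_{n_r}^{g_r}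
-- over index chains with prescribed strict and weak steps.  Splitting a weak step
-- n ≤ n′ into n < n′ or n = n′ yields the recursions that drive everything.  A zero
-- in front of a block either takes an index of its own or is absorbed by its
-- successor; by Pascal's rule this produces the factors C(i, j).  A run of weak
-- ones either keeps adding to the current part or starts a new part; this produces
-- all compositions βₚ of sₚ.  Together they give the expansion of F_α, whose
-- diagonal term has coefficient 1.  Read backwards, the same recursions write every
-- M_γ through F's, so the F_α span LWCQSym.  For independence, each α defines a
-- functional on series: iterate the difference X(0, e) − X(e) i₁ times, fix the
-- first exponent to s₁, and continue with the next block.  On the F_β these
-- functionals form a unitriangular matrix with respect to the size of β.

module Submission where

open import Defs
open import Data.Bool using (Bool; true; false; _∧_; not; if_then_else_; T)
open import Data.Bool.Properties using (∧-identityʳ; ∧-zeroʳ)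
open import Data.Empty using (⊥-elim)
import Data.Integer as ℤ
import Data.Integer.Properties as ℤP
open import Data.List using (List; []; _∷_; _++_; map; concatMap; length; replicate; upTo; filterᵇ; zip; zipWith; foldr; cartesianProductWith; cartesianProduct)
import Data.List.Properties as LP
open import Data.List.Properties using (≡-dec)
open import Data.List.NonEmpty using (toList) renaming (_∷_ to _∷⁺_)
open import Data.List.NonEmpty.Properties using (∷→∷⁺)
open import Data.List.Membership.Propositional using (_∈_)
import Data.List.Membership.Propositional.Properties as ∈P
open import Data.List.Membership.Propositional.Properties.WithK using (unique∧set⇒bag)
open import Data.List.Relation.Binary.BagAndSetEquality using (∼bag⇒↭)
open import Data.List.Relation.Binary.Permutation.Propositional as ↭ using (_↭_; ↭-sym)
open import Data.List.Relation.Binary.Pointwise using (Pointwise; []; _∷_)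
open import Data.List.Relation.Unary.All as All using (All; []; _∷_)
import Data.List.Relation.Unary.All.Properties as AllP
open import Data.List.Relation.Unary.AllPairs using ([]; _∷_)
open import Data.List.Relation.Unary.Any using (here; there)
open import Data.List.Relation.Unary.Unique.Propositional using (Unique)
import Data.List.Relation.Unary.Unique.Propositional.Properties as UniqueP
open import Data.Nat as ℕ using (ℕ; zero; suc; _+_; _≤_; _<_; _<ᵇ_; _≤ᵇ_; _≡ᵇ_; z≤n; s≤s)
open import Data.Nat.Combinatorics using (_C_; nCn≡1; nCk+nC[k+1]≡[n+1]C[k+1]; k>n⇒nCk≡0)
open import Data.Nat.Coprimality using (1-coprimeTo) renaming (sym to coprime-sym)
open import Data.Nat.Induction using (<-rec)
open import Data.Nat.ListAction using (sum)
import Data.Nat.Properties as ℕP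
open import Algebra.Properties.CommutativeSemigroup ℕP.+-commutativeSemigroup using () renaming (interchange to +-interchange)
open import Data.Product using (Σ; _×_; _,_; proj₁; proj₂)
open import Data.Rational using (ℚ; 0ℚ; 1ℚ; mkℚ; _/_; -_; _-_) renaming (_+_ to _+ℚ_; _*_ to _*ℚ_)
import Data.Rational.Properties as ℚP
open import Data.Rational.Solver using (module +-*-Solver)
open import Data.Sum using (_⊎_; inj₁; inj₂)
open import Data.Unit using (⊤; tt)
open import Function using (_∘_)
open import Function.Bundles using (_⇔_; mk⇔; Equivalence)
open import Relation.Binary.Bundles using (Setoid)
open import Relation.Binary.PropositionalEquality
import Relation.Binary.Reasoning.Setoid as SetoidReasoning
open import Relation.Nullary using (¬_; yes; no)
open import Relation.Nullary.Decidable using (isYes; isYes≗does)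

T⇐≡true : ∀ {b} → b ≡ true → T b
T⇐≡true refl = tt

∧-trueˡ : ∀ {a b} → (a ∧ b) ≡ true → a ≡ true
∧-trueˡ {true} _ = refl

∧-trueʳ : ∀ {a b} → (a ∧ b) ≡ true → b ≡ true
∧-trueʳ {true} eq = eq

≡ᵇ-refl : ∀ n → (n ≡ᵇ n) ≡ true
≡ᵇ-refl zero    = refl
≡ᵇ-refl (suc n) = ≡ᵇ-refl n

≢⇒≡ᵇ-false : ∀ {m n} → ¬ m ≡ n → (m ≡ᵇ n) ≡ false
≢⇒≡ᵇ-false {m} {n} m≢n with m ≡ᵇ n in eq
... | true  = ⊥-elim (m≢n (ℕP.≡ᵇ⇒≡ m n (T⇐≡true eq)))
... | false = refl

≡ᵇ-sym : ∀ m n → (m ≡ᵇ n) ≡ (n ≡ᵇ m)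
≡ᵇ-sym zero    zero    = refl
≡ᵇ-sym zero    (suc n) = refl
≡ᵇ-sym (suc m) zero    = refl
≡ᵇ-sym (suc m) (suc n) = ≡ᵇ-sym m n

<ᵇ-suc : ∀ m n → (m <ᵇ suc n) ≡ (m ≤ᵇ n)
<ᵇ-suc zero    n       = refl
<ᵇ-suc (suc m) zero    = refl
<ᵇ-suc (suc m) (suc n) = refl

≤ᵇ-refl : ∀ n → (n ≤ᵇ n) ≡ true
≤ᵇ-refl zero    = refl
≤ᵇ-refl (suc n) = trans (<ᵇ-suc n n) (≤ᵇ-refl n)

≤ᵇ∧≢ᵇ≡<ᵇ : ∀ m n → ((m ≤ᵇ n) ∧ not (m ≡ᵇ n)) ≡ (m <ᵇ n)
≤ᵇ∧≢ᵇ≡<ᵇ zero    zero    = refl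
≤ᵇ∧≢ᵇ≡<ᵇ zero    (suc n) = refl
≤ᵇ∧≢ᵇ≡<ᵇ (suc m) zero    = refl
≤ᵇ∧≢ᵇ≡<ᵇ (suc m) (suc n) rewrite <ᵇ-suc m n = ≤ᵇ∧≢ᵇ≡<ᵇ m n

-- Counting

count : {A : Set} → (A → Bool) → List A → ℕ
count P xs = length (filterᵇ P xs)

Σℕ : {A : Set} → List A → (A → ℕ) → ℕ
Σℕ []       f = 0
Σℕ (x ∷ xs) f = f x + Σℕ xs f

count-∷ : {A : Set} (P : A → Bool) → ∀ x xs →
          count P (x ∷ xs) ≡ (if P x then 1 else 0) + count P xs
count-∷ P x xs with P x
... | true  = refl
... | false = refl

count-++ : {A : Set} (P : A → Bool) → ∀ xs ys → count P (xs ++ ys) ≡ count P xs + count P ys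
count-++ P []       ys = refl
count-++ P (x ∷ xs) ys rewrite count-∷ P x (xs ++ ys) | count-∷ P x xs | count-++ P xs ys =
  sym (ℕP.+-assoc (if P x then 1 else 0) _ _)

count-map : {A B : Set} (P : B → Bool) (f : A → B) → ∀ xs → count P (map f xs) ≡ count (P ∘ f) xs
count-map P f []       = refl
count-map P f (x ∷ xs) rewrite count-∷ P (f x) (map f xs) | count-∷ (P ∘ f) x xs | count-map P f xs = refl

count-concatMap : {A B : Set} (P : B → Bool) (f : A → List B) → ∀ xs →
                  count P (concatMap f xs) ≡ Σℕ xs (λ x → count P (f x))
count-concatMap P f []       = refl
count-concatMap P f (x ∷ xs) =
  trans (count-++ P (f x) (concatMap f xs)) (cong (count P (f x) +_) (count-concatMap P f xs))

count-cong : {A : Set} {P Q : A → Bool} → ∀ xs → All (λ x → P x ≡ Q x) xs → count P xs ≡ count Q xs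
count-cong             []       []         = refl
count-cong {P = P} {Q} (x ∷ xs) (eq ∷ eqs)
  rewrite count-∷ P x xs | count-∷ Q x xs | eq | count-cong xs eqs = refl

count-≗ : {A : Set} {P Q : A → Bool} → ∀ xs → (∀ x → P x ≡ Q x) → count P xs ≡ count Q xs
count-≗ xs eq = count-cong xs (All.tabulate (λ {x} _ → eq x))

count-none : {A : Set} (P : A → Bool) → ∀ xs → All (λ x → P x ≡ false) xs → count P xs ≡ 0
count-none P []       []         = refl
count-none P (x ∷ xs) (eq ∷ eqs) rewrite count-∷ P x xs | eq = count-none P xs eqs

count-split : {A : Set} (P Q : A → Bool) → ∀ xs →
              count P xs ≡ count (λ x → P x ∧ Q x) xs + count (λ x → P x ∧ not (Q x)) xs
count-split P Q [] = refl
count-split P Q (x ∷ xs)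
  rewrite count-∷ P x xs | count-∷ (λ x → P x ∧ Q x) x xs
        | count-∷ (λ x → P x ∧ not (Q x)) x xs | count-split P Q xs
  with P x | Q x
... | true  | true  = refl
... | true  | false = sym (ℕP.+-suc _ _)
... | false | _     = refl

count-guard : {A : Set} (b : Bool) (P : A → Bool) → ∀ xs →
              count (λ x → b ∧ P x) xs ≡ (if b then count P xs else 0)
count-guard true  P xs = refl
count-guard false P xs = count-none _ xs (All.tabulate (λ _ → refl))

Σℕ-cong : {A : Set} (xs : List A) {f g : A → ℕ} → (∀ x → x ∈ xs → f x ≡ g x) → Σℕ xs f ≡ Σℕ xs g
Σℕ-cong []       eq = refl
Σℕ-cong (x ∷ xs) eq = cong₂ _+_ (eq x (here refl)) (Σℕ-cong xs (λ y y∈ → eq y (there y∈)))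

Σℕ-map : {A B : Set} (f : A → B) (xs : List A) (g : B → ℕ) → Σℕ (map f xs) g ≡ Σℕ xs (g ∘ f)
Σℕ-map f []       g = refl
Σℕ-map f (x ∷ xs) g = cong (g (f x) +_) (Σℕ-map f xs g)

Σℕ-+ : {A : Set} (xs : List A) (f g : A → ℕ) → Σℕ xs (λ x → f x + g x) ≡ Σℕ xs f + Σℕ xs g
Σℕ-+ []       f g = refl
Σℕ-+ (x ∷ xs) f g rewrite Σℕ-+ xs f g = +-interchange (f x) (g x) (Σℕ xs f) (Σℕ xs g)

Σℕ-diagonal : ∀ xs n K → Unique xs → n ∈ xs → Σℕ xs (λ m → if n ≡ᵇ m then K else 0) ≡ K
Σℕ-diagonal (m ∷ xs) n K (m∉xs ∷ _) (here refl) rewrite ≡ᵇ-refl n =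
  trans (cong (K +_) (Σℕ-off xs m∉xs)) (ℕP.+-identityʳ K)
  where
  Σℕ-off : ∀ ys → All (λ y → ¬ n ≡ y) ys → Σℕ ys (λ m → if n ≡ᵇ m then K else 0) ≡ 0
  Σℕ-off []       []            = refl
  Σℕ-off (y ∷ ys) (n≢y ∷ n∉ys) rewrite ≢⇒≡ᵇ-false n≢y = Σℕ-off ys n∉ys
Σℕ-diagonal (m ∷ xs) n K (m∉xs ∷ u) (there n∈xs)
  rewrite ≢⇒≡ᵇ-false (λ n≡m → All.lookup m∉xs n∈xs (sym n≡m)) = Σℕ-diagonal xs n K u n∈xs

tuplesOver : List ℕ → ℕ → List (List ℕ)
tuplesOver I zero    = [] ∷ []
tuplesOver I (suc r) = concatMap (λ n → map (n ∷_) (tuplesOver I r)) I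

count-tuplesOver-suc : (P : List ℕ → Bool) → ∀ I r →
  count P (tuplesOver I (suc r)) ≡ Σℕ I (λ n → count (λ ns → P (n ∷ ns)) (tuplesOver I r))
count-tuplesOver-suc P I r =
  trans (count-concatMap P _ I) (Σℕ-cong I (λ n _ → count-map P (n ∷_) (tuplesOver I r)))

count-tuplesOver-map : (P : List ℕ → Bool) (f : ℕ → ℕ) → ∀ I r →
  count P (tuplesOver (map f I) r) ≡ count (P ∘ map f) (tuplesOver I r)
count-tuplesOver-map P f I zero    = trans (count-∷ P [] []) (sym (count-∷ (P ∘ map f) [] []))
count-tuplesOver-map P f I (suc r) = begin
  count P (tuplesOver (map f I) (suc r))
    ≡⟨ count-tuplesOver-suc P (map f I) r ⟩
  Σℕ (map f I) (λ n → count (λ ns → P (n ∷ ns)) (tuplesOver (map f I) r))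
    ≡⟨ Σℕ-map f I _ ⟩
  Σℕ I (λ m → count (λ ns → P (f m ∷ ns)) (tuplesOver (map f I) r))
    ≡⟨ Σℕ-cong I (λ m _ → count-tuplesOver-map (λ ns → P (f m ∷ ns)) f I r) ⟩
  Σℕ I (λ m → count (λ ns → P (f m ∷ map f ns)) (tuplesOver I r))
    ≡⟨ count-tuplesOver-suc (P ∘ map f) I r ⟨
  count (P ∘ map f) (tuplesOver I (suc r)) ∎
  where open ≡-Reasoning

tuplesOver-All : (Q : ℕ → Set) → ∀ I r → All Q I →
                 All (λ ns → length ns ≡ r × All Q ns) (tuplesOver I r)
tuplesOver-All Q I zero    qI = (refl , []) ∷ []
tuplesOver-All Q I (suc r) qI = AllP.concat⁺ (AllP.map⁺ (All.map extend qI))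
  where
  extend : ∀ {n} → Q n → All (λ ns → length ns ≡ suc r × All Q ns) (map (n ∷_) (tuplesOver I r))
  extend qn = AllP.map⁺ (All.map (λ (l , qns) → cong suc l , qn ∷ qns) (tuplesOver-All Q I r qI))

count-tuplesOver-drop : (P : List ℕ → Bool) → ∀ a I r →
  (∀ ns → length ns ≡ r → a ∈ ns → P ns ≡ false) →
  count P (tuplesOver (a ∷ I) r) ≡ count P (tuplesOver I r)
count-tuplesOver-drop P a I zero    never = refl
count-tuplesOver-drop P a I (suc r) never = begin
  count P (tuplesOver (a ∷ I) (suc r))
    ≡⟨ count-tuplesOver-suc P (a ∷ I) r ⟩
  count (λ ns → P (a ∷ ns)) (tuplesOver (a ∷ I) r)
    + Σℕ I (λ n → count (λ ns → P (n ∷ ns)) (tuplesOver (a ∷ I) r))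
    ≡⟨ cong₂ _+_ (count-none _ _ (All.map (λ {ns} (l , _) → never (a ∷ ns) (cong suc l) (here refl))
                                          (tuplesOver-All (λ _ → ⊤) (a ∷ I) r (All.universal _ _))))
                 (Σℕ-cong I (λ n _ → count-tuplesOver-drop (λ ns → P (n ∷ ns)) a I r
                                       (λ ns l a∈ns → never (n ∷ ns) (cong suc l) (there a∈ns)))) ⟩
  Σℕ I (λ n → count (λ ns → P (n ∷ ns)) (tuplesOver I r))
    ≡⟨ count-tuplesOver-suc P I r ⟨
  count P (tuplesOver I (suc r)) ∎
  where open ≡-Reasoning

positions : ℕ → List ℕ
positions L = map suc (upTo L)

positions-suc : ∀ L → positions (suc L) ≡ 1 ∷ map suc (positions L)
positions-suc L = cong (λ ns → 1 ∷ map suc ns) (sym (LP.map-upTo suc L))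

positions-positive : ∀ L → All (1 ≤_) (positions L)
positions-positive L = AllP.map⁺ (All.universal (λ _ → s≤s z≤n) (upTo L))

positions-unique : ∀ L → Unique (positions L)
positions-unique L = UniqueP.map⁺ ℕP.suc-injective (UniqueP.upTo⁺ L)

tuples≡tuplesOver : ∀ L r → tuples L r ≡ tuplesOver (positions L) r
tuples≡tuplesOver L zero    = refl
tuples≡tuplesOver L (suc r) =
  cong (λ ts → concatMap (λ n → map (n ∷_) ts) (positions L)) (tuples≡tuplesOver L r)

-- Coefficients of pattern series

Pat : Set
Pat = List (Bool × ℕ)

chainOK-head : ∀ x y (pat : Pat) ns → chainOK (x ∷ pat) ns ≡ chainOK (y ∷ pat) ns
chainOK-head x y []      []           = refl
chainOK-head x y []      (n ∷ [])     = refl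
chainOK-head x y []      (n ∷ m ∷ ns) = refl
chainOK-head x y (_ ∷ _) []           = refl
chainOK-head x y (_ ∷ _) (n ∷ [])     = refl
chainOK-head x y (_ ∷ _) (n ∷ m ∷ ns) = refl

chainOK-map-suc : ∀ (pat : Pat) ns → chainOK pat (map suc ns) ≡ chainOK pat ns
chainOK-map-suc (_ ∷ (true , _) ∷ pat) (n ∷ m ∷ ns) =
  cong ((n <ᵇ m) ∧_) (chainOK-map-suc ((true , 0) ∷ pat) (m ∷ ns))
chainOK-map-suc (_ ∷ (false , _) ∷ pat) (n ∷ m ∷ ns) =
  cong₂ _∧_ (<ᵇ-suc n m) (chainOK-map-suc ((false , 0) ∷ pat) (m ∷ ns))
chainOK-map-suc []          []           = refl
chainOK-map-suc []          (_ ∷ [])     = refl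
chainOK-map-suc []          (_ ∷ _ ∷ _)  = refl
chainOK-map-suc (_ ∷ [])    []           = refl
chainOK-map-suc (_ ∷ [])    (_ ∷ [])     = refl
chainOK-map-suc (_ ∷ [])    (_ ∷ _ ∷ _)  = refl
chainOK-map-suc (_ ∷ _ ∷ _) []           = refl
chainOK-map-suc (_ ∷ _ ∷ _) (_ ∷ [])     = refl

chainOK⇒head≤ : ∀ x (pat : Pat) n ns → length ns ≡ length pat →
                chainOK (x ∷ pat) (n ∷ ns) ≡ true → All (n ≤_) ns
chainOK⇒head≤ x []              n []       _ _  = []
chainOK⇒head≤ x ((b , _) ∷ pat) n (m ∷ ns) l ok =
  n≤m b ok ∷ All.map (ℕP.≤-trans (n≤m b ok))
                     (chainOK⇒head≤ (b , 0) pat m ns (ℕP.suc-injective l) (∧-trueʳ ok))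
  where
  n≤m : ∀ b → ((if b then n <ᵇ m else n ≤ᵇ m) ∧ chainOK ((b , 0) ∷ pat) (m ∷ ns)) ≡ true → n ≤ m
  n≤m true  ok = ℕP.<⇒≤ (ℕP.<ᵇ⇒< n m (T⇐≡true (∧-trueˡ ok)))
  n≤m false ok = ℕP.≤ᵇ⇒≤ n m (T⇐≡true (∧-trueˡ ok))

exponentAt : Pat → List ℕ → ℕ → ℕ
exponentAt pat ns n = sum (zipWith (λ bg m → if m ≡ᵇ n then proj₂ bg else 0) pat ns)

exponentAt-suc : ∀ (pat : Pat) ns k → exponentAt pat (map suc ns) (suc k) ≡ exponentAt pat ns k
exponentAt-suc []        ns       k = refl
exponentAt-suc (_ ∷ _)   []       k = refl
exponentAt-suc (p ∷ pat) (m ∷ ns) k = cong ((if m ≡ᵇ k then proj₂ p else 0) +_) (exponentAt-suc pat ns k)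

exponentAt-1 : ∀ (pat : Pat) ns → All (1 ≤_) ns → exponentAt pat (map suc ns) 1 ≡ 0
exponentAt-1 []        ns           _       = refl
exponentAt-1 (_ ∷ _)   []           _       = refl
exponentAt-1 (_ ∷ pat) (suc m ∷ ns) (_ ∷ a) = exponentAt-1 pat ns a

expo-map-suc : ∀ L (pat : Pat) ns → All (1 ≤_) ns →
               expo (suc L) pat (map suc ns) ≡ 0 ∷ expo L pat ns
expo-map-suc L pat ns ns≥1 = begin
  map (exponentAt pat (map suc ns)) (positions (suc L))
    ≡⟨ cong (map (exponentAt pat (map suc ns))) (positions-suc L) ⟩
  exponentAt pat (map suc ns) 1 ∷ map (exponentAt pat (map suc ns)) (map suc (positions L))
    ≡⟨ cong₂ _∷_ (exponentAt-1 pat ns ns≥1) (sym (LP.map-∘ (positions L))) ⟩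
  0 ∷ map (exponentAt pat (map suc ns) ∘ suc) (positions L)
    ≡⟨ cong (0 ∷_) (LP.map-cong (exponentAt-suc pat ns) (positions L)) ⟩
  0 ∷ map (exponentAt pat ns) (positions L) ∎
  where open ≡-Reasoning

expo-1∷map-suc : ∀ L b g (pat : Pat) ns → All (1 ≤_) ns →
                 expo (suc L) ((b , g) ∷ pat) (1 ∷ map suc ns) ≡ (g + 0) ∷ expo L pat ns
expo-1∷map-suc L b g pat ns ns≥1 = begin
  map w (positions (suc L))
    ≡⟨ cong (map w) (positions-suc L) ⟩
  w 1 ∷ map w (map suc (positions L))
    ≡⟨ cong₂ _∷_ (cong (g +_) (exponentAt-1 pat ns ns≥1)) (sym (LP.map-∘ (positions L))) ⟩
  (g + 0) ∷ map (w ∘ suc) (positions L)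
    ≡⟨ cong ((g + 0) ∷_) (LP.map-cong-local (All.map (λ {k} → w-suc k) (positions-positive L))) ⟩
  (g + 0) ∷ map (exponentAt pat ns) (positions L) ∎
  where
  open ≡-Reasoning
  w = exponentAt ((b , g) ∷ pat) (1 ∷ map suc ns)
  w-suc : ∀ k → 1 ≤ k → w (suc k) ≡ exponentAt pat ns k
  w-suc (suc k) _ = exponentAt-suc pat ns (suc k)

expo-merge : ∀ L b g x h (pat : Pat) n ns b′ →
             expo L ((b , g) ∷ (x , h) ∷ pat) (n ∷ n ∷ ns) ≡ expo L ((b′ , g + h) ∷ pat) (n ∷ ns)
expo-merge L b g x h pat n ns b′ = LP.map-cong merged (positions L)
  where
  merged : ∀ k → exponentAt ((b , g) ∷ (x , h) ∷ pat) (n ∷ n ∷ ns) k ≡ exponentAt ((b′ , g + h) ∷ pat) (n ∷ ns) k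
  merged k with n ≡ᵇ k
  ... | true  = sym (ℕP.+-assoc g h _)
  ... | false = refl

expo-flag : ∀ L b b′ g (pat : Pat) ns → expo L ((b , g) ∷ pat) ns ≡ expo L ((b′ , g) ∷ pat) ns
expo-flag L b b′ g pat []      = refl
expo-flag L b b′ g pat (_ ∷ _) = refl

Hits : Pat → Monomial → List ℕ → Bool
Hits pat e ns = chainOK pat ns ∧ isYes (≡-dec ℕ._≟_ (expo (length e) pat ns) e)

coefPat≡count : ∀ pat e → coefPat pat e ≡ count (Hits pat e) (tuplesOver (positions (length e)) (length pat))
coefPat≡count pat e = cong (count (Hits pat e)) (tuples≡tuplesOver (length e) (length pat))

isYes-≡-dec-∷ : ∀ x y xs ys →
                isYes (≡-dec ℕ._≟_ (x ∷ xs) (y ∷ ys)) ≡ (x ≡ᵇ y) ∧ isYes (≡-dec ℕ._≟_ xs ys)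
isYes-≡-dec-∷ x y xs ys = trans (isYes≗does _) (cong ((x ≡ᵇ y) ∧_) (sym (isYes≗does _)))

data StartsStrict : Pat → Set where
  empty  : StartsStrict []
  strict : ∀ h pat → StartsStrict ((true , h) ∷ pat)

∧-rotate : ∀ a b c → (a ∧ (b ∧ c)) ≡ (b ∧ (a ∧ c))
∧-rotate true  b     c = refl
∧-rotate false true  c = refl
∧-rotate false false c = refl

strict-1∷-no-1 : ∀ b g pat → StartsStrict pat → ∀ e ns → length ns ≡ length pat → 1 ∈ ns →
                 Hits ((b , g) ∷ pat) e (1 ∷ ns) ≡ false
strict-1∷-no-1 b g .((true , h) ∷ pat) (strict h pat) e (m ∷ ns) l 1∈m∷ns
  with chainOK ((b , g) ∷ (true , h) ∷ pat) (1 ∷ m ∷ ns) in ok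
... | false = refl
... | true  = ⊥-elim (1∉m∷ns 1∈m∷ns)
  where
  1<m : 1 < m
  1<m = ℕP.<ᵇ⇒< 1 m (T⇐≡true (∧-trueˡ ok))
  1∉m∷ns : ¬ 1 ∈ m ∷ ns
  1∉m∷ns (here refl)  = ℕP.<-irrefl refl 1<m
  1∉m∷ns (there 1∈ns) =
    ℕP.<⇒≱ 1<m (All.lookup (chainOK⇒head≤ (true , 0) pat m ns (ℕP.suc-injective l) (∧-trueʳ ok)) 1∈ns)

chainOK-1∷map-suc : ∀ b g pat → StartsStrict pat → ∀ ns → All (1 ≤_) ns →
                    chainOK ((b , g) ∷ pat) (1 ∷ map suc ns) ≡ chainOK pat ns
chainOK-1∷map-suc b g .[] empty []      _ = refl
chainOK-1∷map-suc b g .[] empty (_ ∷ _) _ = refl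
chainOK-1∷map-suc b g .((true , h) ∷ []) (strict h []) [] _ = refl
chainOK-1∷map-suc b g .((true , h) ∷ _ ∷ _) (strict h (_ ∷ _)) [] _ = refl
chainOK-1∷map-suc b g .((true , h) ∷ pat) (strict h pat) (zero ∷ ns) (() ∷ _)
chainOK-1∷map-suc b g .((true , h) ∷ pat) (strict h pat) (suc m ∷ ns) _ =
  trans (chainOK-map-suc ((true , 0) ∷ pat) (suc m ∷ ns)) (chainOK-head _ _ pat (suc m ∷ ns))

hits-1∷map-suc : ∀ b g pat → StartsStrict pat → ∀ x es ns → All (1 ≤_) ns →
                 Hits ((b , g) ∷ pat) (x ∷ es) (1 ∷ map suc ns) ≡ ((x ≡ᵇ g) ∧ Hits pat es ns)
hits-1∷map-suc b g pat st x es ns ns≥1 = begin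
  chainOK pat₁ (1 ∷ map suc ns) ∧ isYes (≡-dec ℕ._≟_ (expo (suc L) pat₁ (1 ∷ map suc ns)) (x ∷ es))
    ≡⟨ cong₂ (λ c d → c ∧ isYes (≡-dec ℕ._≟_ d (x ∷ es)))
             (chainOK-1∷map-suc b g pat st ns ns≥1) (expo-1∷map-suc L b g pat ns ns≥1) ⟩
  chainOK pat ns ∧ isYes (≡-dec ℕ._≟_ ((g + 0) ∷ expo L pat ns) (x ∷ es))
    ≡⟨ cong (chainOK pat ns ∧_) (isYes-≡-dec-∷ (g + 0) x _ es) ⟩
  chainOK pat ns ∧ (((g + 0) ≡ᵇ x) ∧ isYes (≡-dec ℕ._≟_ (expo L pat ns) es))
    ≡⟨ cong (λ c → chainOK pat ns ∧ (c ∧ isYes (≡-dec ℕ._≟_ (expo L pat ns) es))) (trans (cong (_≡ᵇ x) (ℕP.+-identityʳ g)) (≡ᵇ-sym g x)) ⟩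
  chainOK pat ns ∧ ((x ≡ᵇ g) ∧ isYes (≡-dec ℕ._≟_ (expo L pat ns) es))
    ≡⟨ ∧-rotate (chainOK pat ns) (x ≡ᵇ g) _ ⟩
  (x ≡ᵇ g) ∧ Hits pat es ns ∎
  where
  open ≡-Reasoning
  pat₁ = (b , g) ∷ pat
  L = length es

hits-map-suc : ∀ pat x es ns → All (1 ≤_) ns →
               Hits pat (x ∷ es) (map suc ns) ≡ ((x ≡ᵇ 0) ∧ Hits pat es ns)
hits-map-suc pat x es ns ns≥1 = begin
  chainOK pat (map suc ns) ∧ isYes (≡-dec ℕ._≟_ (expo (suc L) pat (map suc ns)) (x ∷ es))
    ≡⟨ cong₂ (λ c d → c ∧ isYes (≡-dec ℕ._≟_ d (x ∷ es)))
             (chainOK-map-suc pat ns) (expo-map-suc L pat ns ns≥1) ⟩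
  chainOK pat ns ∧ isYes (≡-dec ℕ._≟_ (0 ∷ expo L pat ns) (x ∷ es))
    ≡⟨ cong (chainOK pat ns ∧_) (isYes-≡-dec-∷ 0 x _ es) ⟩
  chainOK pat ns ∧ ((0 ≡ᵇ x) ∧ isYes (≡-dec ℕ._≟_ (expo L pat ns) es))
    ≡⟨ cong (λ c → chainOK pat ns ∧ (c ∧ isYes (≡-dec ℕ._≟_ (expo L pat ns) es))) (≡ᵇ-sym 0 x) ⟩
  chainOK pat ns ∧ ((x ≡ᵇ 0) ∧ isYes (≡-dec ℕ._≟_ (expo L pat ns) es))
    ≡⟨ ∧-rotate (chainOK pat ns) (x ≡ᵇ 0) _ ⟩
  (x ≡ᵇ 0) ∧ Hits pat es ns ∎
  where
  open ≡-Reasoning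
  L = length es

-- A tuple hitting x ∷ es starts either with the index 1, which then carries the
-- exponent x = g, or with an index ≥ 2, and then x = 0 and all indices are shifted.
coefPat-prefix : ∀ b g pat → StartsStrict pat → ∀ x es →
  coefPat ((b , g) ∷ pat) (x ∷ es)
    ≡ (if x ≡ᵇ g then coefPat pat es else 0) + (if x ≡ᵇ 0 then coefPat ((b , g) ∷ pat) es else 0)
coefPat-prefix b g pat st x es = begin
  coefPat pat₁ (x ∷ es)
    ≡⟨ trans (coefPat≡count pat₁ (x ∷ es)) (cong (λ I → count P (tuplesOver I (suc R))) (positions-suc L)) ⟩
  count P (tuplesOver (1 ∷ I₂) (suc R))
    ≡⟨ count-tuplesOver-suc P (1 ∷ I₂) R ⟩
  count (λ ns → P (1 ∷ ns)) (tuplesOver (1 ∷ I₂) R) + Σℕ I₂ (λ n → count (λ ns → P (n ∷ ns)) (tuplesOver (1 ∷ I₂) R))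
    ≡⟨ cong₂ _+_ starts-at-1 starts-after-1 ⟩
  (if x ≡ᵇ g then coefPat pat es else 0) + (if x ≡ᵇ 0 then coefPat pat₁ es else 0) ∎
  where
  open ≡-Reasoning
  pat₁ = (b , g) ∷ pat
  L = length es
  R = length pat
  I = positions L
  I₂ = map suc I
  P = Hits pat₁ (x ∷ es)
  valid : ∀ r → All (λ ns → length ns ≡ r × All (1 ≤_) ns) (tuplesOver I r)
  valid r = tuplesOver-All (1 ≤_) I r (positions-positive L)

  starts-at-1 : count (λ ns → P (1 ∷ ns)) (tuplesOver (1 ∷ I₂) R) ≡ (if x ≡ᵇ g then coefPat pat es else 0)
  starts-at-1 = begin
    count (λ ns → P (1 ∷ ns)) (tuplesOver (1 ∷ I₂) R)
      ≡⟨ count-tuplesOver-drop _ 1 I₂ R (strict-1∷-no-1 b g pat st (x ∷ es)) ⟩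
    count (λ ns → P (1 ∷ ns)) (tuplesOver I₂ R)
      ≡⟨ count-tuplesOver-map _ suc I R ⟩
    count (λ ns → P (1 ∷ map suc ns)) (tuplesOver I R)
      ≡⟨ count-cong _ (All.map (λ {ns} (_ , ns≥1) → hits-1∷map-suc b g pat st x es ns ns≥1) (valid R)) ⟩
    count (λ ns → (x ≡ᵇ g) ∧ Hits pat es ns) (tuplesOver I R)
      ≡⟨ count-guard (x ≡ᵇ g) (Hits pat es) (tuplesOver I R) ⟩
    (if x ≡ᵇ g then count (Hits pat es) (tuplesOver I R) else 0)
      ≡⟨ cong (λ c → if x ≡ᵇ g then c else 0) (coefPat≡count pat es) ⟨
    (if x ≡ᵇ g then coefPat pat es else 0) ∎

  never-back-to-1 : ∀ n → n ∈ I₂ → ∀ ns → length ns ≡ R → 1 ∈ ns → P (n ∷ ns) ≡ false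
  never-back-to-1 n n∈I₂ ns l 1∈ns with chainOK pat₁ (n ∷ ns) in ok
  ... | false = refl
  ... | true  with ∈P.∈-map⁻ suc n∈I₂
  ...   | k , k∈I , refl = ⊥-elim (ℕP.<⇒≱ (s≤s (All.lookup (positions-positive L) k∈I))
                                          (All.lookup (chainOK⇒head≤ (b , g) pat n ns l ok) 1∈ns))

  starts-after-1 : Σℕ I₂ (λ n → count (λ ns → P (n ∷ ns)) (tuplesOver (1 ∷ I₂) R))
                 ≡ (if x ≡ᵇ 0 then coefPat pat₁ es else 0)
  starts-after-1 = begin
    Σℕ I₂ (λ n → count (λ ns → P (n ∷ ns)) (tuplesOver (1 ∷ I₂) R))
      ≡⟨ Σℕ-cong I₂ (λ n n∈I₂ → count-tuplesOver-drop _ 1 I₂ R (never-back-to-1 n n∈I₂)) ⟩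
    Σℕ I₂ (λ n → count (λ ns → P (n ∷ ns)) (tuplesOver I₂ R))
      ≡⟨ count-tuplesOver-suc P I₂ R ⟨
    count P (tuplesOver I₂ (suc R))
      ≡⟨ count-tuplesOver-map P suc I (suc R) ⟩
    count (P ∘ map suc) (tuplesOver I (suc R))
      ≡⟨ count-cong _ (All.map (λ {ns} (_ , ns≥1) → hits-map-suc pat₁ x es ns ns≥1) (valid (suc R))) ⟩
    count (λ ns → (x ≡ᵇ 0) ∧ Hits pat₁ es ns) (tuplesOver I (suc R))
      ≡⟨ count-guard (x ≡ᵇ 0) (Hits pat₁ es) (tuplesOver I (suc R)) ⟩
    (if x ≡ᵇ 0 then count (Hits pat₁ es) (tuplesOver I (suc R)) else 0)
      ≡⟨ cong (λ c → if x ≡ᵇ 0 then c else 0) (coefPat≡count pat₁ es) ⟨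
    (if x ≡ᵇ 0 then coefPat pat₁ es else 0) ∎

∧-not-swap : ∀ a c e d → (((a ∧ c) ∧ e) ∧ not d) ≡ (((a ∧ not d) ∧ c) ∧ e)
∧-not-swap true  c     e     true  = ∧-zeroʳ (c ∧ e)
∧-not-swap true  c     e     false = ∧-identityʳ (c ∧ e)
∧-not-swap false c     e     d     = refl

-- Splitting n₁ ≤ n₂ into n₁ < n₂ and n₁ = n₂; in the second case the first two
-- variables coincide and their exponents add up.
coefPat-weak : ∀ b g h pat e →
  coefPat ((b , g) ∷ (false , h) ∷ pat) e ≡ coefPat ((b , g) ∷ (true , h) ∷ pat) e + coefPat ((b , g + h) ∷ pat) e
coefPat-weak b g h pat e = begin
  coefPat weakPat e
    ≡⟨ coefPat≡count weakPat e ⟩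
  count Pw (tuplesOver I (2 + R))
    ≡⟨ count-tuplesOver-suc Pw I (suc R) ⟩
  Σℕ I (λ n → count (λ ns → Pw (n ∷ ns)) (tuplesOver I (suc R)))
    ≡⟨ Σℕ-cong I (λ n _ → trans (count-tuplesOver-suc _ I R) (Σℕ-cong I (λ m _ → split n m))) ⟩
  Σℕ I (λ n → Σℕ I (λ m → (if n ≡ᵇ m then count (λ ns → Pm (n ∷ ns)) Ts else 0) + count (λ ns → Ps (n ∷ m ∷ ns)) Ts))
    ≡⟨ Σℕ-cong I (λ n n∈I → trans (Σℕ-+ I _ _)
                   (cong₂ _+_ (Σℕ-diagonal I n _ (positions-unique L) n∈I) (sym (count-tuplesOver-suc _ I R)))) ⟩
  Σℕ I (λ n → count (λ ns → Pm (n ∷ ns)) Ts + count (λ ns → Ps (n ∷ ns)) (tuplesOver I (suc R)))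
    ≡⟨ Σℕ-+ I _ _ ⟩
  Σℕ I (λ n → count (λ ns → Pm (n ∷ ns)) Ts) + Σℕ I (λ n → count (λ ns → Ps (n ∷ ns)) (tuplesOver I (suc R)))
    ≡⟨ cong₂ _+_ (count-tuplesOver-suc Pm I R) (count-tuplesOver-suc Ps I (suc R)) ⟨
  count Pm (tuplesOver I (suc R)) + count Ps (tuplesOver I (2 + R))
    ≡⟨ ℕP.+-comm (count Pm (tuplesOver I (suc R))) _ ⟩
  count Ps (tuplesOver I (2 + R)) + count Pm (tuplesOver I (suc R))
    ≡⟨ cong₂ _+_ (coefPat≡count strictPat e) (coefPat≡count mergedPat e) ⟨
  coefPat strictPat e + coefPat mergedPat e ∎
  where
  open ≡-Reasoning
  weakPat   = (b , g) ∷ (false , h) ∷ pat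
  strictPat = (b , g) ∷ (true , h) ∷ pat
  mergedPat = (b , g + h) ∷ pat
  L = length e
  R = length pat
  I = positions L
  Ts = tuplesOver I R
  Pw = Hits weakPat e
  Ps = Hits strictPat e
  Pm = Hits mergedPat e

  unequal : ∀ n m ns → (Pw (n ∷ m ∷ ns) ∧ not (n ≡ᵇ m)) ≡ Ps (n ∷ m ∷ ns)
  unequal n m ns = trans (∧-not-swap (n ≤ᵇ m) _ _ (n ≡ᵇ m))
    (cong₂ (λ c d → (c ∧ d) ∧ isYes (≡-dec ℕ._≟_ (expo L strictPat (n ∷ m ∷ ns)) e))
           (≤ᵇ∧≢ᵇ≡<ᵇ n m) (chainOK-head _ _ pat (m ∷ ns)))

  equal : ∀ n m → count (λ ns → Pw (n ∷ m ∷ ns) ∧ (n ≡ᵇ m)) Ts ≡ (if n ≡ᵇ m then count (λ ns → Pm (n ∷ ns)) Ts else 0)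
  equal n m with n ≡ᵇ m in n≡ᵇm
  ... | false = count-none _ Ts (All.universal (λ ns → ∧-zeroʳ (Pw (n ∷ m ∷ ns))) Ts)
  ... | true with ℕP.≡ᵇ⇒≡ n m (T⇐≡true n≡ᵇm)
  ...   | refl = count-≗ Ts (λ ns → trans (∧-identityʳ _) (cong₂ _∧_
            (cong₂ _∧_ (≤ᵇ-refl n) (chainOK-head _ _ pat (n ∷ ns)))
            (cong (λ d → isYes (≡-dec ℕ._≟_ d e)) (expo-merge L b g false h pat n ns b))))

  split : ∀ n m → count (λ ns → Pw (n ∷ m ∷ ns)) Ts
                ≡ (if n ≡ᵇ m then count (λ ns → Pm (n ∷ ns)) Ts else 0) + count (λ ns → Ps (n ∷ m ∷ ns)) Ts
  split n m = trans (count-split _ (λ _ → n ≡ᵇ m) Ts) (cong₂ _+_ (equal n m) (count-≗ Ts (unequal n m)))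

coefPat-flag : ∀ b b′ g pat e → coefPat ((b , g) ∷ pat) e ≡ coefPat ((b′ , g) ∷ pat) e
coefPat-flag b b′ g pat e = begin
  coefPat ((b , g) ∷ pat) e                              ≡⟨ coefPat≡count ((b , g) ∷ pat) e ⟩
  count (Hits ((b , g) ∷ pat) e) (tuplesOver I (suc R))  ≡⟨ count-≗ (tuplesOver I (suc R)) same-hits ⟩
  count (Hits ((b′ , g) ∷ pat) e) (tuplesOver I (suc R)) ≡⟨ coefPat≡count ((b′ , g) ∷ pat) e ⟨
  coefPat ((b′ , g) ∷ pat) e                             ∎
  where
  open ≡-Reasoning
  I = positions (length e)
  R = length pat
  same-hits : ∀ ns → Hits ((b , g) ∷ pat) e ns ≡ Hits ((b′ , g) ∷ pat) e ns
  same-hits ns = cong₂ (λ c d → c ∧ isYes (≡-dec ℕ._≟_ d e)) (chainOK-head _ _ pat ns) (expo-flag (length e) b b′ g pat ns)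

coefPat-[] : ∀ e → coefPat [] e ≡ (if allZero e then 1 else 0)
coefPat-[] e = trans (count-∷ (Hits [] e) [] []) (trans (ℕP.+-identityʳ _) (cong (λ c → if c then 1 else 0) (zero-test e)))
  where
  zero-test : ∀ e → isYes (≡-dec ℕ._≟_ (expo (length e) [] []) e) ≡ allZero e
  zero-test []       = refl
  zero-test (x ∷ es) = begin
    isYes (≡-dec ℕ._≟_ (map (exponentAt [] []) (positions (suc (length es)))) (x ∷ es))
      ≡⟨ cong (λ I → isYes (≡-dec ℕ._≟_ (map (exponentAt [] []) I) (x ∷ es))) (positions-suc (length es)) ⟩
    isYes (≡-dec ℕ._≟_ (0 ∷ map (exponentAt [] []) (map suc (positions (length es)))) (x ∷ es))
      ≡⟨ isYes-≡-dec-∷ 0 x _ es ⟩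
    (0 ≡ᵇ x) ∧ isYes (≡-dec ℕ._≟_ (map (exponentAt [] []) (map suc (positions (length es)))) es)
      ≡⟨ cong₂ _∧_ (≡ᵇ-sym 0 x) (cong (λ d → isYes (≡-dec ℕ._≟_ d es)) (sym (LP.map-∘ (positions (length es))))) ⟩
    (x ≡ᵇ 0) ∧ isYes (≡-dec ℕ._≟_ (expo (length es) [] []) es)
      ≡⟨ cong ((x ≡ᵇ 0) ∧_) (zero-test es) ⟩
    allZero (x ∷ es) ∎
    where open ≡-Reasoning

ℕ→ℚ≡mkℚ : ∀ n → ℕ→ℚ n ≡ mkℚ (ℤ.+ n) 0 (coprime-sym (1-coprimeTo n))
ℕ→ℚ≡mkℚ n = ℚP.normalize-coprime _

ℕ→ℚ-+ : ∀ m n → ℕ→ℚ (m ℕ.+ n) ≡ ℕ→ℚ m +ℚ ℕ→ℚ n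
ℕ→ℚ-+ m n = trans (ℚP./-cong {p₁ = ℤ.+ (m ℕ.+ n)} {q₁ = 1} {q₂ = 1}
                     (cong₂ ℤ._+_ (sym (ℤP.*-identityʳ (ℤ.+ m))) (sym (ℤP.*-identityʳ (ℤ.+ n)))) refl) sums
  where
  sums : ((ℤ.+ m ℤ.* ℤ.+ 1) ℤ.+ (ℤ.+ n ℤ.* ℤ.+ 1)) / 1 ≡ ℕ→ℚ m +ℚ ℕ→ℚ n
  sums rewrite ℕ→ℚ≡mkℚ m | ℕ→ℚ≡mkℚ n = refl

ℕ→ℚ-* : ∀ m n → ℕ→ℚ (m ℕ.* n) ≡ ℕ→ℚ m *ℚ ℕ→ℚ n
ℕ→ℚ-* m n = trans (ℚP./-cong {p₁ = ℤ.+ (m ℕ.* n)} {q₁ = 1} {q₂ = 1} (ℤP.pos-* m n) refl) products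
  where
  products : (ℤ.+ m ℤ.* ℤ.+ n) / 1 ≡ ℕ→ℚ m *ℚ ℕ→ℚ n
  products rewrite ℕ→ℚ≡mkℚ m | ℕ→ℚ≡mkℚ n = refl

ℕ→ℚ-if : ∀ (b : Bool) k → ℕ→ℚ (if b then k else 0) ≡ (if b then ℕ→ℚ k else 0ℚ)
ℕ→ℚ-if true  k = refl
ℕ→ℚ-if false k = refl

-- Series algebra

-- _≋_ wrapped in a record, so that both series can be recovered from a proof by unification.
record _≈_ (f g : Series) : Set where
  constructor ≋⇒≈
  field ≈⇒≋ : f ≋ g
open _≈_ public

infix 4 _≈_

≈-refl : ∀ {f} → f ≈ f
≈-refl = ≋⇒≈ (λ _ → refl)

≈-sym : ∀ {f g} → f ≈ g → g ≈ f
≈-sym (≋⇒≈ f≋g) = ≋⇒≈ (λ e → sym (f≋g e))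

≈-trans : ∀ {f g h} → f ≈ g → g ≈ h → f ≈ h
≈-trans (≋⇒≈ f≋g) (≋⇒≈ g≋h) = ≋⇒≈ (λ e → trans (f≋g e) (g≋h e))

≈-setoid : Setoid _ _
≈-setoid = record
  { Carrier = Series ; _≈_ = _≈_
  ; isEquivalence = record { refl = ≈-refl ; sym = ≈-sym ; trans = ≈-trans } }

module ≈-Reasoning = SetoidReasoning ≈-setoid

⊕-cong : ∀ {f f′ g g′} → f ≈ f′ → g ≈ g′ → f ⊕ g ≈ f′ ⊕ g′
⊕-cong (≋⇒≈ p) (≋⇒≈ q) = ≋⇒≈ (λ e → cong₂ _+ℚ_ (p e) (q e))

•-cong : ∀ c {f g} → f ≈ g → c • f ≈ c • g
•-cong c (≋⇒≈ p) = ≋⇒≈ (λ e → cong (c *ℚ_) (p e))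

•-assoc : ∀ p q f → p • (q • f) ≈ (p *ℚ q) • f
•-assoc p q f = ≋⇒≈ (λ e → sym (ℚP.*-assoc p q (f e)))

-- g ▹ S is the series Σ_{n ≥ 1} x_n^g · S(x_{n+1}, x_{n+2}, …): the first
-- exponent of a monomial is either g, and S sees the rest, or 0, and n > 1.
_▹_ : ℕ → Series → Series
(g ▹ S) []       = 0ℚ
(g ▹ S) (x ∷ es) = (if x ≡ᵇ g then S es else 0ℚ) +ℚ (if x ≡ᵇ 0 then (g ▹ S) es else 0ℚ)

infixr 8 _▹_

▹-cong : ∀ g {f h} → f ≈ h → g ▹ f ≈ g ▹ h
▹-cong g {f} {h} (≋⇒≈ p) = ≋⇒≈ pointwise
  where
  pointwise : (g ▹ f) ≋ (g ▹ h)
  pointwise []       = refl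
  pointwise (x ∷ es) = cong₂ _+ℚ_ (cong (λ c → if x ≡ᵇ g then c else 0ℚ) (p es))
                                  (cong (λ c → if x ≡ᵇ 0 then c else 0ℚ) (pointwise es))

▹-⊕ : ∀ g f h → g ▹ (f ⊕ h) ≈ g ▹ f ⊕ g ▹ h
▹-⊕ g f h = ≋⇒≈ pointwise
  where
  open +-*-Solver
  pointwise : (g ▹ (f ⊕ h)) ≋ (g ▹ f ⊕ g ▹ h)
  pointwise []       = sym (ℚP.+-identityʳ 0ℚ)
  pointwise (x ∷ es) with x ≡ᵇ g | x ≡ᵇ 0
  ... | true  | true  rewrite pointwise es =
    solve 4 (λ a b c d → (a :+ b) :+ (c :+ d) := (a :+ c) :+ (b :+ d)) refl (f es) (h es) ((g ▹ f) es) ((g ▹ h) es)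
  ... | true  | false = solve 2 (λ a b → (a :+ b) :+ con 0ℚ := (a :+ con 0ℚ) :+ (b :+ con 0ℚ)) refl (f es) (h es)
  ... | false | true  rewrite pointwise es =
    solve 2 (λ a b → con 0ℚ :+ (a :+ b) := (con 0ℚ :+ a) :+ (con 0ℚ :+ b)) refl ((g ▹ f) es) ((g ▹ h) es)
  ... | false | false = refl

▹-• : ∀ g c f → g ▹ (c • f) ≈ c • (g ▹ f)
▹-• g c f = ≋⇒≈ pointwise
  where
  open +-*-Solver
  pointwise : (g ▹ (c • f)) ≋ (c • (g ▹ f))
  pointwise []       = sym (ℚP.*-zeroʳ c)
  pointwise (x ∷ es) with x ≡ᵇ g | x ≡ᵇ 0
  ... | true  | true  rewrite pointwise es = sym (ℚP.*-distribˡ-+ c (f es) ((g ▹ f) es))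
  ... | true  | false = solve 2 (λ c a → c :* a :+ con 0ℚ := c :* (a :+ con 0ℚ)) refl c (f es)
  ... | false | true  rewrite pointwise es = solve 2 (λ c a → con 0ℚ :+ c :* a := c :* (con 0ℚ :+ a)) refl c ((g ▹ f) es)
  ... | false | false = solve 1 (λ c → con 0ℚ :+ con 0ℚ := c :* (con 0ℚ :+ con 0ℚ)) refl c

▹-0S : ∀ g → g ▹ 0S ≈ 0S
▹-0S g = ≋⇒≈ pointwise
  where
  pointwise : (g ▹ 0S) ≋ 0S
  pointwise []       = refl
  pointwise (x ∷ es) with x ≡ᵇ g | x ≡ᵇ 0
  ... | true  | true  rewrite pointwise es = refl
  ... | true  | false = refl
  ... | false | true  rewrite pointwise es = refl
  ... | false | false = refl

ΣS-cong : {A : Set} (xs : List A) {f g : A → Series} → (∀ x → x ∈ xs → f x ≈ g x) → ΣS xs f ≈ ΣS xs g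
ΣS-cong []       eq = ≈-refl
ΣS-cong (x ∷ xs) eq = ⊕-cong (eq x (here refl)) (ΣS-cong xs (λ y y∈ → eq y (there y∈)))

ΣS-≗ : {A : Set} (xs : List A) {f g : A → Series} → (∀ x → f x ≈ g x) → ΣS xs f ≈ ΣS xs g
ΣS-≗ xs eq = ΣS-cong xs (λ x _ → eq x)

ΣS-++ : {A : Set} (xs ys : List A) (f : A → Series) → ΣS (xs ++ ys) f ≈ ΣS xs f ⊕ ΣS ys f
ΣS-++ []       ys f = ≋⇒≈ (λ e → sym (ℚP.+-identityˡ _))
ΣS-++ (x ∷ xs) ys f = ≋⇒≈ (λ e → trans (cong (f x e +ℚ_) (≈⇒≋ (ΣS-++ xs ys f) e)) (sym (ℚP.+-assoc (f x e) _ _)))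

ΣS-map : {A B : Set} (h : A → B) (xs : List A) (f : B → Series) → ΣS (map h xs) f ≈ ΣS xs (f ∘ h)
ΣS-map h []       f = ≈-refl
ΣS-map h (x ∷ xs) f = ⊕-cong {f (h x)} ≈-refl (ΣS-map h xs f)

ΣS-cartesianProductWith : {A B C : Set} (h : A → B → C) (xs : List A) (ys : List B) (f : C → Series) →
  ΣS (cartesianProductWith h xs ys) f ≈ ΣS xs (λ x → ΣS ys (λ y → f (h x y)))
ΣS-cartesianProductWith h []       ys f = ≈-refl
ΣS-cartesianProductWith h (x ∷ xs) ys f =
  ≈-trans (ΣS-++ (map (h x) ys) _ f) (⊕-cong (ΣS-map (h x) ys f) (ΣS-cartesianProductWith h xs ys f))

ΣS-↭ : {A : Set} {xs ys : List A} (f : A → Series) → xs ↭ ys → ΣS xs f ≈ ΣS ys f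
ΣS-↭ f ↭.refl          = ≈-refl
ΣS-↭ f (↭.prep x p)    = ⊕-cong {f x} ≈-refl (ΣS-↭ f p)
ΣS-↭ f (↭.swap {ys = ys} x y p) = ≋⇒≈ (λ e → trans (cong (λ s → f x e +ℚ (f y e +ℚ s)) (≈⇒≋ (ΣS-↭ f p) e))
  (solve 3 (λ a b c → a :+ (b :+ c) := b :+ (a :+ c)) refl (f x e) (f y e) (ΣS ys f e)))
  where open +-*-Solver
ΣS-↭ f (↭.trans p q)   = ≈-trans (ΣS-↭ f p) (ΣS-↭ f q)

•-ΣS : {A : Set} (c : ℚ) (xs : List A) (f : A → Series) → c • ΣS xs f ≈ ΣS xs (λ x → c • f x)
•-ΣS c []       f = ≋⇒≈ (λ e → ℚP.*-zeroʳ c)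
•-ΣS c (x ∷ xs) f = ≋⇒≈ (λ e → trans (ℚP.*-distribˡ-+ c (f x e) _) (cong (c *ℚ f x e +ℚ_) (≈⇒≋ (•-ΣS c xs f) e)))

▹-ΣS : {A : Set} (g : ℕ) (xs : List A) (f : A → Series) → g ▹ ΣS xs f ≈ ΣS xs (λ x → g ▹ f x)
▹-ΣS g []       f = ▹-0S g
▹-ΣS g (x ∷ xs) f = ≈-trans (▹-⊕ g (f x) (ΣS xs f)) (⊕-cong {g ▹ f x} ≈-refl (▹-ΣS g xs f))

seriesPat-prefix : ∀ b g pat → StartsStrict pat → seriesPat ((b , g) ∷ pat) ≈ g ▹ seriesPat pat
seriesPat-prefix b g pat st = ≋⇒≈ pointwise
  where
  pointwise : seriesPat ((b , g) ∷ pat) ≋ (g ▹ seriesPat pat)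
  pointwise []       = refl
  pointwise (x ∷ es) = trans (cong ℕ→ℚ (coefPat-prefix b g pat st x es))
    (trans (ℕ→ℚ-+ (if x ≡ᵇ g then coefPat pat es else 0) (if x ≡ᵇ 0 then coefPat ((b , g) ∷ pat) es else 0))
      (cong₂ _+ℚ_ (ℕ→ℚ-if (x ≡ᵇ g) (coefPat pat es))
      (trans (ℕ→ℚ-if (x ≡ᵇ 0) (coefPat ((b , g) ∷ pat) es)) (cong (λ c → if x ≡ᵇ 0 then c else 0ℚ) (pointwise es)))))

seriesPat-weak : ∀ b g h pat →
  seriesPat ((b , g) ∷ (false , h) ∷ pat) ≈ seriesPat ((b , g) ∷ (true , h) ∷ pat) ⊕ seriesPat ((b , g ℕ.+ h) ∷ pat)
seriesPat-weak b g h pat = ≋⇒≈ (λ e → trans (cong ℕ→ℚ (coefPat-weak b g h pat e))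
  (ℕ→ℚ-+ (coefPat ((b , g) ∷ (true , h) ∷ pat) e) (coefPat ((b , g ℕ.+ h) ∷ pat) e)))

seriesPat-flag : ∀ b b′ g pat → seriesPat ((b , g) ∷ pat) ≈ seriesPat ((b′ , g) ∷ pat)
seriesPat-flag b b′ g pat = ≋⇒≈ (λ e → cong ℕ→ℚ (coefPat-flag b b′ g pat e))

seriesPat-[] : seriesPat [] ≈ 1S
seriesPat-[] = ≋⇒≈ (λ e → trans (cong ℕ→ℚ (coefPat-[] e)) (ℕ→ℚ-if (allZero e) 1))

Σq : {A : Set} → List A → (A → ℚ) → ℚ
Σq []       f = 0ℚ
Σq (x ∷ xs) f = f x +ℚ Σq xs f

ΣS-pointwise : {A : Set} (xs : List A) (f : A → Series) → ∀ e → ΣS xs f e ≡ Σq xs (λ x → f x e)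
ΣS-pointwise []       f e = refl
ΣS-pointwise (x ∷ xs) f e = cong (f x e +ℚ_) (ΣS-pointwise xs f e)

Σq-cong : {A : Set} (xs : List A) {f g : A → ℚ} → (∀ x → f x ≡ g x) → Σq xs f ≡ Σq xs g
Σq-cong []       eq = refl
Σq-cong (x ∷ xs) eq = cong₂ _+ℚ_ (eq x) (Σq-cong xs eq)

Σq-map : {A B : Set} (h : A → B) (xs : List A) (f : B → ℚ) → Σq (map h xs) f ≡ Σq xs (f ∘ h)
Σq-map h []       f = refl
Σq-map h (x ∷ xs) f = cong (f (h x) +ℚ_) (Σq-map h xs f)

Σq-++ : {A : Set} (xs ys : List A) (f : A → ℚ) → Σq (xs ++ ys) f ≡ Σq xs f +ℚ Σq ys f
Σq-++ []       ys f = sym (ℚP.+-identityˡ _)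
Σq-++ (x ∷ xs) ys f = trans (cong (f x +ℚ_) (Σq-++ xs ys f)) (sym (ℚP.+-assoc (f x) _ _))

Σq-+ : {A : Set} (xs : List A) (f g : A → ℚ) → Σq xs (λ x → f x +ℚ g x) ≡ Σq xs f +ℚ Σq xs g
Σq-+ []       f g = sym (ℚP.+-identityʳ 0ℚ)
Σq-+ (x ∷ xs) f g rewrite Σq-+ xs f g =
  solve 4 (λ a b c d → (a :+ b) :+ (c :+ d) := (a :+ c) :+ (b :+ d)) refl (f x) (g x) (Σq xs f) (Σq xs g)
  where open +-*-Solver

Σq-upTo-suc : ∀ n (f : ℕ → ℚ) → Σq (upTo (suc n)) f ≡ f 0 +ℚ Σq (upTo n) (f ∘ suc)
Σq-upTo-suc n f =
  cong (f 0 +ℚ_) (trans (cong (λ js → Σq js f) (sym (LP.map-upTo suc n))) (Σq-map suc (upTo n) f))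

Σq-upTo-∷ʳ : ∀ n (f : ℕ → ℚ) → Σq (upTo (suc n)) f ≡ Σq (upTo n) f +ℚ (f n +ℚ 0ℚ)
Σq-upTo-∷ʳ n f = trans (cong (λ js → Σq js f) (sym (LP.upTo-∷ʳ n))) (Σq-++ (upTo n) (n ∷ []) f)

Σq-pascal : ∀ i (h : ℕ → ℚ) →
  Σq (upTo (2 ℕ.+ i)) (λ j → ℕ→ℚ (suc i C j) *ℚ h j)
    ≡ Σq (upTo (suc i)) (λ j → ℕ→ℚ (i C j) *ℚ h (suc j)) +ℚ Σq (upTo (suc i)) (λ j → ℕ→ℚ (i C j) *ℚ h j)
Σq-pascal i h = begin
  Σq (upTo (2 ℕ.+ i)) (λ j → ℕ→ℚ (suc i C j) *ℚ h j)
    ≡⟨ Σq-upTo-suc (suc i) (λ j → ℕ→ℚ (suc i C j) *ℚ h j) ⟩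
  1ℚ *ℚ h 0 +ℚ Σq (upTo (suc i)) (λ j → ℕ→ℚ (suc i C suc j) *ℚ h (suc j))
    ≡⟨ cong (1ℚ *ℚ h 0 +ℚ_) (trans (Σq-cong (upTo (suc i)) pascal) (Σq-+ (upTo (suc i)) (λ j → ℕ→ℚ (i C j) *ℚ h (suc j)) B)) ⟩
  1ℚ *ℚ h 0 +ℚ (A +ℚ Σq (upTo (suc i)) B)
    ≡⟨ cong (λ s → 1ℚ *ℚ h 0 +ℚ (A +ℚ s)) (Σq-upTo-∷ʳ i B) ⟩
  1ℚ *ℚ h 0 +ℚ (A +ℚ (Σq (upTo i) B +ℚ (ℕ→ℚ (i C suc i) *ℚ h (suc i) +ℚ 0ℚ)))
    ≡⟨ cong (λ c → 1ℚ *ℚ h 0 +ℚ (A +ℚ (Σq (upTo i) B +ℚ (ℕ→ℚ c *ℚ h (suc i) +ℚ 0ℚ)))) (k>n⇒nCk≡0 (ℕP.n<1+n i)) ⟩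
  1ℚ *ℚ h 0 +ℚ (A +ℚ (Σq (upTo i) B +ℚ (0ℚ *ℚ h (suc i) +ℚ 0ℚ)))
    ≡⟨ solve 4 (λ h₀ a b hᵢ → con 1ℚ :* h₀ :+ (a :+ (b :+ (con 0ℚ :* hᵢ :+ con 0ℚ))) := a :+ (con 1ℚ :* h₀ :+ b))
               refl (h 0) A (Σq (upTo i) B) (h (suc i)) ⟩
  A +ℚ (1ℚ *ℚ h 0 +ℚ Σq (upTo i) B)
    ≡⟨ cong (A +ℚ_) (Σq-upTo-suc i (λ j → ℕ→ℚ (i C j) *ℚ h j)) ⟨
  A +ℚ Σq (upTo (suc i)) (λ j → ℕ→ℚ (i C j) *ℚ h j) ∎
  where
  open ≡-Reasoning
  open +-*-Solver
  A = Σq (upTo (suc i)) (λ j → ℕ→ℚ (i C j) *ℚ h (suc j))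
  B = λ j → ℕ→ℚ (i C suc j) *ℚ h (suc j)
  pascal : ∀ j → ℕ→ℚ (suc i C suc j) *ℚ h (suc j) ≡ ℕ→ℚ (i C j) *ℚ h (suc j) +ℚ B j
  pascal j = trans (cong (λ c → ℕ→ℚ c *ℚ h (suc j)) (sym (nCk+nC[k+1]≡[n+1]C[k+1] i j)))
                   (trans (cong (_*ℚ h (suc j)) (ℕ→ℚ-+ (i C j) (i C suc j)))
                          (ℚP.*-distribʳ-+ (h (suc j)) (ℕ→ℚ (i C j)) (ℕ→ℚ (i C suc j))))

_▹*_ : List ℕ → Series → Series
[]       ▹* S = S
(g ∷ gs) ▹* S = g ▹ (gs ▹* S)

infixr 8 _▹*_

▹*-cong : ∀ gs {f h} → f ≈ h → gs ▹* f ≈ gs ▹* h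
▹*-cong []       f≈h = f≈h
▹*-cong (g ∷ gs) f≈h = ▹-cong g (▹*-cong gs f≈h)

▹*-++ : ∀ gs hs S → (gs ++ hs) ▹* S ≡ gs ▹* hs ▹* S
▹*-++ []       hs S = refl
▹*-++ (g ∷ gs) hs S = cong (g ▹_) (▹*-++ gs hs S)

▹*-• : ∀ gs c S → gs ▹* (c • S) ≈ c • (gs ▹* S)
▹*-• []       c S = ≈-refl
▹*-• (g ∷ gs) c S = ≈-trans (▹-cong g (▹*-• gs c S)) (▹-• g c (gs ▹* S))

▹*-ΣS : {A : Set} (gs : List ℕ) (xs : List A) (f : A → Series) → gs ▹* ΣS xs f ≈ ΣS xs (λ x → gs ▹* f x)
▹*-ΣS []       xs f = ≈-refl
▹*-ΣS (g ∷ gs) xs f = ≈-trans (▹-cong g (▹*-ΣS gs xs f)) (▹-ΣS g xs (λ x → gs ▹* f x))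

•▹*-ΣS : {A : Set} (c : ℚ) (gs : List ℕ) (xs : List A) (f : A → Series) →
         c • (gs ▹* ΣS xs f) ≈ ΣS xs (λ x → c • (gs ▹* f x))
•▹*-ΣS c gs xs f = ≈-trans (•-cong c (▹*-ΣS gs xs f)) (•-ΣS c xs (λ x → gs ▹* f x))

mapTrue-strict : ∀ γ → StartsStrict (map (true ,_) γ)
mapTrue-strict []      = empty
mapTrue-strict (_ ∷ _) = strict _ _

Mseq-∷ : ∀ g γ → Mseq (g ∷ γ) ≈ g ▹ Mseq γ
Mseq-∷ g γ = seriesPat-prefix true g _ (mapTrue-strict γ)

Mseq-++ : ∀ γ δ → Mseq (γ ++ δ) ≈ γ ▹* Mseq δ
Mseq-++ []      δ = ≈-refl
Mseq-++ (g ∷ γ) δ = ≈-trans (Mseq-∷ g (γ ++ δ)) (▹-cong g (Mseq-++ γ δ))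

blockSeries : Bool → ℕ × ℕ → Pat → Series
blockSeries b it P = seriesPat (blockPat b it ++ P)

-- The first zero either sits at an index of its own or shares it with the next variable.
blockSeries-suc : ∀ b i t P → blockSeries b (suc i , t) P ≈ 0 ▹ blockSeries b (i , t) P ⊕ blockSeries b (i , t) P
blockSeries-suc b zero    t P = ≈-trans (seriesPat-weak b 0 1 _)
  (⊕-cong (≈-trans (seriesPat-prefix b 0 _ (strict _ _)) (▹-cong 0 (seriesPat-flag true b 1 _))) ≈-refl)
blockSeries-suc b (suc i) t P = ≈-trans (seriesPat-weak b 0 0 _)
  (⊕-cong (≈-trans (seriesPat-prefix b 0 _ (strict _ _)) (▹-cong 0 (seriesPat-flag true b 0 _))) ≈-refl)

zeros : ℕ → List ℕ
zeros j = replicate j 0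

blockSeries-expand : ∀ b i t P →
  blockSeries b (i , t) P ≈ ΣS (upTo (suc i)) (λ j → ℕ→ℚ (i C j) • (zeros j ▹* blockSeries b (0 , t) P))
blockSeries-expand b zero    t P = ≋⇒≈ (λ e → sym (trans (ℚP.+-identityʳ _) (ℚP.*-identityˡ _)))
blockSeries-expand b (suc i) t P = ≋⇒≈ λ e → begin
  Z (suc i) e
    ≡⟨ ≈⇒≋ (blockSeries-suc b i t P) e ⟩
  (0 ▹ Z i) e +ℚ Z i e
    ≡⟨ cong₂ _+ℚ_ (≈⇒≋ (≈-trans (▹-cong 0 (blockSeries-expand b i t P)) shift) e) (≈⇒≋ (blockSeries-expand b i t P) e) ⟩
  ΣS (upTo (suc i)) (λ j → ℕ→ℚ (i C j) • W (suc j)) e +ℚ ΣS (upTo (suc i)) (λ j → ℕ→ℚ (i C j) • W j) e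
    ≡⟨ cong₂ _+ℚ_ (ΣS-pointwise (upTo (suc i)) (λ j → ℕ→ℚ (i C j) • W (suc j)) e)
                  (ΣS-pointwise (upTo (suc i)) (λ j → ℕ→ℚ (i C j) • W j) e) ⟩
  Σq (upTo (suc i)) (λ j → ℕ→ℚ (i C j) *ℚ W (suc j) e) +ℚ Σq (upTo (suc i)) (λ j → ℕ→ℚ (i C j) *ℚ W j e)
    ≡⟨ Σq-pascal i (λ j → W j e) ⟨
  Σq (upTo (2 ℕ.+ i)) (λ j → ℕ→ℚ (suc i C j) *ℚ W j e)
    ≡⟨ ΣS-pointwise (upTo (2 ℕ.+ i)) (λ j → ℕ→ℚ (suc i C j) • W j) e ⟨
  ΣS (upTo (2 ℕ.+ i)) (λ j → ℕ→ℚ (suc i C j) • W j) e ∎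
  where
  open ≡-Reasoning
  Z = λ k → blockSeries b (k , t) P
  W = λ j → zeros j ▹* Z 0
  shift : 0 ▹ ΣS (upTo (suc i)) (λ j → ℕ→ℚ (i C j) • W j) ≈ ΣS (upTo (suc i)) (λ j → ℕ→ℚ (i C j) • W (suc j))
  shift = ≈-trans (▹-ΣS 0 (upTo (suc i)) _) (ΣS-≗ (upTo (suc i)) (λ j → ▹-• 0 (ℕ→ℚ (i C j)) (W j)))

-- The leading exponent g collects the ones already merged into the first part.
onesSeries : ℕ → ℕ → Pat → Series
onesSeries g m P = seriesPat ((true , g) ∷ (replicate m (false , 1) ++ P))

onesSeries-zero : ∀ g P → StartsStrict P → onesSeries g 0 P ≈ g ▹ seriesPat P
onesSeries-zero g P st = seriesPat-prefix true g P st

onesSeries-suc : ∀ g m P → onesSeries g (suc m) P ≈ g ▹ onesSeries 1 m P ⊕ onesSeries (suc g) m P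
onesSeries-suc g m P = ≈-trans (seriesPat-weak true g 1 _)
  (⊕-cong (seriesPat-prefix true g _ (strict _ _))
          (≋⇒≈ (λ e → cong (λ h → seriesPat ((true , h) ∷ (replicate m (false , 1) ++ P)) e) (ℕP.+-comm g 1))))

blockSeries-0 : ∀ b t P → blockSeries b (0 , t) P ≈ onesSeries 1 t P
blockSeries-0 b t P = ≈-trans (seriesPat-flag b true 1 _)
  (≋⇒≈ (λ e → cong (λ ones → seriesPat ((true , 1) ∷ (ones ++ P)) e) (zip-replicate t)))
  where
  zip-replicate : ∀ t → zip (replicate t false) (replicate t 1) ≡ replicate t (false , 1)
  zip-replicate zero    = refl
  zip-replicate (suc t) = cong ((false , 1) ∷_) (zip-replicate t)

-- Compositions of g + m whose first part is at least g.
compositionsFrom : ℕ → ℕ → List (List ℕ)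
compositionsFrom g zero    = (g ∷ []) ∷ []
compositionsFrom g (suc m) = map (g ∷_) (compositionsFrom 1 m) ++ compositionsFrom (suc g) m

onesSeries-expand : ∀ g m P → StartsStrict P →
                    onesSeries g m P ≈ ΣS (compositionsFrom g m) (λ c → c ▹* seriesPat P)
onesSeries-expand g zero    P st = ≈-trans (onesSeries-zero g P st) (≋⇒≈ (λ e → sym (ℚP.+-identityʳ _)))
onesSeries-expand g (suc m) P st = begin
  onesSeries g (suc m) P
    ≈⟨ onesSeries-suc g m P ⟩
  g ▹ onesSeries 1 m P ⊕ onesSeries (suc g) m P
    ≈⟨ ⊕-cong (▹-cong g (onesSeries-expand 1 m P st)) (onesSeries-expand (suc g) m P st) ⟩
  g ▹ ΣS (compositionsFrom 1 m) (λ c → c ▹* S) ⊕ ΣS (compositionsFrom (suc g) m) (λ c → c ▹* S)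
    ≈⟨ ⊕-cong (≈-trans (▹-ΣS g (compositionsFrom 1 m) _) (≈-sym (ΣS-map (g ∷_) (compositionsFrom 1 m) _))) ≈-refl ⟩
  ΣS (map (g ∷_) (compositionsFrom 1 m)) (λ c → c ▹* S) ⊕ ΣS (compositionsFrom (suc g) m) (λ c → c ▹* S)
    ≈⟨ ΣS-++ (map (g ∷_) (compositionsFrom 1 m)) _ _ ⟨
  ΣS (compositionsFrom g (suc m)) (λ c → c ▹* S) ∎
  where
  open ≈-Reasoning
  S = seriesPat P

-- Expansion of F in the monomial basis

blocksPat : List (ℕ × ℕ) → Pat
blocksPat = concatMap (blockPat true)

blocksPat-strict : ∀ bs → StartsStrict (blocksPat bs)
blocksPat-strict []                = empty
blocksPat-strict ((zero  , _) ∷ _) = strict _ _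
blocksPat-strict ((suc _ , _) ∷ _) = strict _ _

-- F α with the irrelevant first flag set like all others, so that blocks peel off uniformly.
Fᵇ : List (ℕ × ℕ) → Series
Fᵇ bs = seriesPat (blocksPat bs)

F≈Fᵇ : ∀ α → F α ≈ Fᵇ (toList α)
F≈Fᵇ ((zero  , t) ∷⁺ bs) = seriesPat-flag false true 1 _
F≈Fᵇ ((suc i , t) ∷⁺ bs) = seriesPat-flag false true 0 _

Fᵇ-∷ : ∀ i t bs → Fᵇ ((i , t) ∷ bs)
       ≈ ΣS (upTo (suc i)) (λ j → ℕ→ℚ (i C j) • (zeros j ▹* ΣS (compositionsFrom 1 t) (λ c → c ▹* Fᵇ bs)))
Fᵇ-∷ i t bs = ≈-trans (blockSeries-expand true i t P) (ΣS-≗ (upTo (suc i)) (λ j → •-cong (ℕ→ℚ (i C j))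
  (▹*-cong (zeros j) (≈-trans (blockSeries-0 true t P) (onesSeries-expand 1 t P (blocksPat-strict bs))))))
  where
  P = blocksPat bs

decompositions : List (ℕ × ℕ) → List Decomp
decompositions []             = [] ∷ []
decompositions ((i , t) ∷ bs) =
  cartesianProductWith _∷_ (cartesianProduct (upTo (suc i)) (compositionsFrom 1 t)) (decompositions bs)

cOfᵇ : List (ℕ × ℕ) → Decomp → ℚ
cOfᵇ bs d = foldr _*ℚ_ 1ℚ (zipWith (λ it jc → ℕ→ℚ (proj₁ it C proj₁ jc)) bs d)

term : List (ℕ × ℕ) → Decomp → Series
term bs d = cOfᵇ bs d • Mseq (βOf d)

term-∷ : ∀ i t bs j c d → ℕ→ℚ (i C j) • ((zeros j ++ c) ▹* term bs d) ≈ term ((i , t) ∷ bs) ((j , c) ∷ d)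
term-∷ i t bs j c d = begin
  ℕ→ℚ (i C j) • ((zeros j ++ c) ▹* (cOfᵇ bs d • Mseq (βOf d)))
    ≈⟨ •-cong (ℕ→ℚ (i C j)) (▹*-• (zeros j ++ c) (cOfᵇ bs d) (Mseq (βOf d))) ⟩
  ℕ→ℚ (i C j) • (cOfᵇ bs d • ((zeros j ++ c) ▹* Mseq (βOf d)))
    ≈⟨ •-assoc (ℕ→ℚ (i C j)) (cOfᵇ bs d) _ ⟩
  (ℕ→ℚ (i C j) *ℚ cOfᵇ bs d) • ((zeros j ++ c) ▹* Mseq (βOf d))
    ≈⟨ •-cong (ℕ→ℚ (i C j) *ℚ cOfᵇ bs d) (Mseq-++ (zeros j ++ c) (βOf d)) ⟨
  term ((i , t) ∷ bs) ((j , c) ∷ d) ∎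
  where open ≈-Reasoning

Fᵇ-expand : ∀ bs → Fᵇ bs ≈ ΣS (decompositions bs) (term bs)
Fᵇ-expand []             = ≋⇒≈ (λ e → sym (trans (ℚP.+-identityʳ _) (ℚP.*-identityˡ _)))
Fᵇ-expand ((i , t) ∷ bs) = begin
  Fᵇ ((i , t) ∷ bs)
    ≈⟨ Fᵇ-∷ i t bs ⟩
  ΣS (upTo (suc i)) (λ j → ℕ→ℚ (i C j) • (zeros j ▹* ΣS (compositionsFrom 1 t) (λ c → c ▹* Fᵇ bs)))
    ≈⟨ ΣS-≗ (upTo (suc i)) (λ j → •▹*-ΣS (ℕ→ℚ (i C j)) (zeros j) (compositionsFrom 1 t) _) ⟩
  ΣS (upTo (suc i)) (λ j → ΣS (compositionsFrom 1 t) (λ c → ℕ→ℚ (i C j) • (zeros j ▹* c ▹* Fᵇ bs)))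
    ≈⟨ ΣS-≗ (upTo (suc i)) (λ j → ΣS-≗ (compositionsFrom 1 t) (λ c → expand-tail j c)) ⟩
  ΣS (upTo (suc i)) (λ j → ΣS (compositionsFrom 1 t) (λ c → ΣS (decompositions bs) (λ d → term bs′ ((j , c) ∷ d))))
    ≈⟨ ΣS-cartesianProductWith _,_ (upTo (suc i)) (compositionsFrom 1 t) _ ⟨
  ΣS (cartesianProduct (upTo (suc i)) (compositionsFrom 1 t)) (λ jc → ΣS (decompositions bs) (λ d → term bs′ (jc ∷ d)))
    ≈⟨ ΣS-cartesianProductWith _∷_ (cartesianProduct (upTo (suc i)) (compositionsFrom 1 t)) (decompositions bs) (term bs′) ⟨
  ΣS (decompositions bs′) (term bs′) ∎
  where
  open ≈-Reasoning
  bs′ = (i , t) ∷ bs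
  expand-tail : ∀ j c → ℕ→ℚ (i C j) • (zeros j ▹* c ▹* Fᵇ bs) ≈ ΣS (decompositions bs) (λ d → term bs′ ((j , c) ∷ d))
  expand-tail j c = begin
    ℕ→ℚ (i C j) • (zeros j ▹* c ▹* Fᵇ bs)
      ≡⟨ cong (ℕ→ℚ (i C j) •_) (▹*-++ (zeros j) c (Fᵇ bs)) ⟨
    ℕ→ℚ (i C j) • ((zeros j ++ c) ▹* Fᵇ bs)
      ≈⟨ •-cong (ℕ→ℚ (i C j)) (▹*-cong (zeros j ++ c) (Fᵇ-expand bs)) ⟩
    ℕ→ℚ (i C j) • ((zeros j ++ c) ▹* ΣS (decompositions bs) (term bs))
      ≈⟨ •▹*-ΣS (ℕ→ℚ (i C j)) (zeros j ++ c) (decompositions bs) (term bs) ⟩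
    ΣS (decompositions bs) (λ d → ℕ→ℚ (i C j) • ((zeros j ++ c) ▹* term bs d))
      ≈⟨ ΣS-≗ (decompositions bs) (term-∷ i t bs j c) ⟩
    ΣS (decompositions bs) (λ d → term bs′ ((j , c) ∷ d)) ∎

data CompositionFrom (g m : ℕ) : List ℕ → Set where
  composition : ∀ {a c} → g ≤ a → All (0 <_) c → a + sum c ≡ g + m → CompositionFrom g m (a ∷ c)

compositionsFrom-sound : ∀ g m {c} → c ∈ compositionsFrom g m → CompositionFrom g m c
compositionsFrom-sound g zero    (here refl) = composition ℕP.≤-refl [] refl
compositionsFrom-sound g (suc m) c∈ with ∈P.∈-++⁻ (map (g ∷_) (compositionsFrom 1 m)) c∈
... | inj₁ c∈map with ∈P.∈-map⁻ (g ∷_) c∈map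
...   | _ , c₁∈ , refl with compositionsFrom-sound 1 m c₁∈
...     | composition 1≤a c>0 sum≡ = composition ℕP.≤-refl (1≤a ∷ c>0) (cong (g +_) sum≡)
compositionsFrom-sound g (suc m) c∈ | inj₂ c∈rest with compositionsFrom-sound (suc g) m c∈rest
... | composition g<a c>0 sum≡ = composition (ℕP.<⇒≤ g<a) c>0 (trans sum≡ (sym (ℕP.+-suc g m)))

sum-positive≡0 : ∀ {c} → All (0 <_) c → sum c ≡ 0 → c ≡ []
sum-positive≡0 []      _  = refl
sum-positive≡0 (s≤s _ ∷ _) ()

compositionsFrom-complete : ∀ g m {a c} → g ≤ a → All (0 <_) c → a + sum c ≡ g + m → a ∷ c ∈ compositionsFrom g m
compositionsFrom-complete g zero {a} {c} g≤a c>0 sum≡ with ℕP.m≤n⇒m<n∨m≡n g≤a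
... | inj₁ g<a = ⊥-elim (ℕP.<⇒≱ (ℕP.<-≤-trans g<a (ℕP.m≤m+n a (sum c))) (ℕP.≤-reflexive (trans sum≡ (ℕP.+-identityʳ g))))
... | inj₂ refl with sum-positive≡0 c>0 (ℕP.+-cancelˡ-≡ g (sum c) 0 sum≡)
...   | refl = here refl
compositionsFrom-complete g (suc m) g≤a c>0 sum≡ with ℕP.m≤n⇒m<n∨m≡n g≤a
... | inj₁ g<a = ∈P.∈-++⁺ʳ (map (g ∷_) (compositionsFrom 1 m))
                   (compositionsFrom-complete (suc g) m g<a c>0 (trans sum≡ (ℕP.+-suc g m)))
compositionsFrom-complete g (suc m) g≤a []          sum≡ | inj₂ refl = ⊥-elim (ℕP.0≢1+n (ℕP.+-cancelˡ-≡ g 0 (suc m) sum≡))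
compositionsFrom-complete g (suc m) g≤a (x>0 ∷ c>0) sum≡ | inj₂ refl = ∈P.∈-++⁺ˡ
  (∈P.∈-map⁺ (g ∷_) (compositionsFrom-complete 1 m x>0 c>0 (ℕP.+-cancelˡ-≡ g _ _ sum≡)))

compositionsFrom-unique : ∀ g m → Unique (compositionsFrom g m)
compositionsFrom-unique g zero    = [] ∷ []
compositionsFrom-unique g (suc m) = UniqueP.++⁺ (UniqueP.map⁺ LP.∷-injectiveʳ (compositionsFrom-unique 1 m))
                                                (compositionsFrom-unique (suc g) m) disjoint
  where
  disjoint : ∀ {c} → ¬ (c ∈ map (g ∷_) (compositionsFrom 1 m) × c ∈ compositionsFrom (suc g) m)
  disjoint (c∈map , c∈rest) with ∈P.∈-map⁻ (g ∷_) c∈map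
  ... | _ , _ , refl with compositionsFrom-sound (suc g) m c∈rest
  ...   | composition g<g _ _ = ℕP.<-irrefl refl g<g

∈compositions⇔IsComposition : ∀ t c → (c ∈ compositionsFrom 1 t) ⇔ IsComposition (suc t) c
∈compositions⇔IsComposition t c = mk⇔ to from
  where
  to : c ∈ compositionsFrom 1 t → IsComposition (suc t) c
  to c∈ with compositionsFrom-sound 1 t c∈
  ... | composition a>0 c>0 sum≡ = a>0 ∷ c>0 , sum≡
  from : IsComposition (suc t) c → c ∈ compositionsFrom 1 t
  from (a>0 ∷ c>0 , sum≡) = compositionsFrom-complete 1 t a>0 c>0 sum≡

∈decompositions⇔BlockOK : ∀ bs d → (d ∈ decompositions bs) ⇔ Pointwise BlockOK bs d
∈decompositions⇔BlockOK bs d = mk⇔ (to bs) (from bs)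
  where
  to : ∀ bs {d} → d ∈ decompositions bs → Pointwise BlockOK bs d
  to []             (here refl) = []
  to ((i , t) ∷ bs) d∈
    with _ , _ , jc∈ , d∈bs , refl ← ∈P.∈-cartesianProductWith⁻ _∷_ (cartesianProduct (upTo (suc i)) (compositionsFrom 1 t)) (decompositions bs) d∈
    with j∈ , c∈ ← ∈P.∈-cartesianProduct⁻ (upTo (suc i)) (compositionsFrom 1 t) jc∈
    = (ℕP.≤-pred (∈P.∈-upTo⁻ j∈) , Equivalence.to (∈compositions⇔IsComposition t _) c∈) ∷ to bs d∈bs
  from : ∀ bs {d} → Pointwise BlockOK bs d → d ∈ decompositions bs
  from []             []                      = here refl
  from ((i , t) ∷ bs) ((j≤i , isComp) ∷ rest) = ∈P.∈-cartesianProductWith⁺ _∷_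
    (∈P.∈-cartesianProduct⁺ (∈P.∈-upTo⁺ (s≤s j≤i)) (Equivalence.from (∈compositions⇔IsComposition t _) isComp))
    (from bs rest)

decompositions-unique : ∀ bs → Unique (decompositions bs)
decompositions-unique []             = [] ∷ []
decompositions-unique ((i , t) ∷ bs) = UniqueP.cartesianProductWith⁺ _∷_ LP.∷-injective
  (UniqueP.cartesianProduct⁺ (UniqueP.upTo⁺ (suc i)) (compositionsFrom-unique 1 t)) (decompositions-unique bs)

F-expansion : (α : LWC) (ds : List Decomp) → Unique ds → (∀ d → (d ∈ ds) ⇔ ValidDecomp α d) →
              F α ≋ ΣS ds (λ d → cOf α d • Mseq (βOf d))
F-expansion α ds ds-unique ds-valid = ≈⇒≋ (begin
  F α                                    ≈⟨ F≈Fᵇ α ⟩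
  Fᵇ bs                                  ≈⟨ Fᵇ-expand bs ⟩
  ΣS (decompositions bs) (term bs)       ≈⟨ ΣS-↭ (term bs) (↭-sym ds↭decompositions) ⟩
  ΣS ds (λ d → cOf α d • Mseq (βOf d))   ∎)
  where
  open ≈-Reasoning
  bs = toList α
  same-elements : ∀ {d} → (d ∈ ds) ⇔ (d ∈ decompositions bs)
  same-elements {d} = mk⇔ (λ d∈ → Equivalence.from (∈decompositions⇔BlockOK bs d) (Equivalence.to (ds-valid d) d∈))
                          (λ d∈ → Equivalence.from (ds-valid d) (Equivalence.to (∈decompositions⇔BlockOK bs d) d∈))
  ds↭decompositions : ds ↭ decompositions bs
  ds↭decompositions = ∼bag⇒↭ (unique∧set⇒bag ds-unique (decompositions-unique bs) same-elements)

zeros-++-cancel : ∀ j i {xs ys : List ℕ} → (∀ zs → ¬ xs ≡ 0 ∷ zs) → (∀ zs → ¬ ys ≡ 0 ∷ zs) →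
                  zeros j ++ xs ≡ zeros i ++ ys → j ≡ i × xs ≡ ys
zeros-++-cancel zero    zero    xs≢ ys≢ eq = refl , eq
zeros-++-cancel zero    (suc i) xs≢ ys≢ eq = ⊥-elim (xs≢ _ eq)
zeros-++-cancel (suc j) zero    xs≢ ys≢ eq = ⊥-elim (ys≢ _ (sym eq))
zeros-++-cancel (suc j) (suc i) xs≢ ys≢ eq with zeros-++-cancel j i xs≢ ys≢ (LP.∷-injectiveʳ eq)
... | refl , xs≡ys = refl , xs≡ys

flatᵇ : List (ℕ × ℕ) → List ℕ
flatᵇ bs = concatMap (λ b → replicate (proj₁ b) 0 ++ (suc (proj₂ b) ∷ [])) bs

-- Reading β = α block by block forces j = i and βₚ = (s), since neither starts with 0.
cOfᵇ-diagonal : ∀ bs d → Pointwise BlockOK bs d → βOf d ≡ flatᵇ bs → cOfᵇ bs d ≡ 1ℚ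
cOfᵇ-diagonal []             []                      []                                 _   = refl
cOfᵇ-diagonal ((i , t) ∷ bs) ((j , a ∷ c) ∷ d) ((j≤i , a>0 ∷ c>0 , sum≡) ∷ valid) β≡α
  with zeros-++-cancel j i {(a ∷ c) ++ βOf d} {suc t ∷ flatᵇ bs}
         (λ _ eq → ℕP.<-irrefl (sym (LP.∷-injectiveˡ eq)) a>0) (λ _ ())
         (trans (sym (LP.++-assoc (zeros j) (a ∷ c) (βOf d))) (trans β≡α (LP.++-assoc (zeros i) (suc t ∷ []) (flatᵇ bs))))
... | refl , rest≡ with LP.∷-injective rest≡
...   | refl , tail≡ with sum-positive≡0 c>0 (ℕP.+-cancelˡ-≡ (suc t) (sum c) 0 (trans sum≡ (sym (ℕP.+-identityʳ (suc t)))))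
...     | refl = trans (cong (λ n → ℕ→ℚ n *ℚ cOfᵇ bs d) (nCn≡1 i)) (cong (ℕ→ℚ 1 *ℚ_) (cOfᵇ-diagonal bs d valid tail≡))

-- Spanning

Span : (LWC → Series) → Series → Set
Span G X = Σ (List (ℚ × LWC)) λ cs → X ≈ lin G cs

Span₁ : (LWC → Series) → Series → Set
Span₁ G X = Σ ℚ λ c₀ → Σ (List (ℚ × LWC)) λ cs → X ≈ c₀ • 1S ⊕ lin G cs

scale : ℚ → List (ℚ × LWC) → List (ℚ × LWC)
scale c = map (λ (q , β) → c *ℚ q , β)

lin-++ : ∀ G cs ds → lin G (cs ++ ds) ≈ lin G cs ⊕ lin G ds
lin-++ G cs ds = ΣS-++ cs ds _

lin-scale : ∀ G c cs → c • lin G cs ≈ lin G (scale c cs)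
lin-scale G c []             = ≋⇒≈ (λ e → ℚP.*-zeroʳ c)
lin-scale G c ((q , β) ∷ cs) = ≋⇒≈ (λ e → trans (ℚP.*-distribˡ-+ c (q *ℚ G β e) _)
  (cong₂ _+ℚ_ (sym (ℚP.*-assoc c q (G β e))) (≈⇒≋ (lin-scale G c cs) e)))

▹-lin : ∀ g G cs → g ▹ lin G cs ≈ lin (λ β → g ▹ G β) cs
▹-lin g G cs = ≈-trans (▹-ΣS g cs _) (ΣS-≗ cs (λ (q , β) → ▹-• g q (G β)))

span-≈ : ∀ {G X Y} → X ≈ Y → Span G Y → Span G X
span-≈ X≈Y (cs , Y≈) = cs , ≈-trans X≈Y Y≈

span-⊕ : ∀ {G X Y} → Span G X → Span G Y → Span G (X ⊕ Y)
span-⊕ {G} (cs , X≈) (ds , Y≈) = cs ++ ds , ≈-trans (⊕-cong X≈ Y≈) (≈-sym (lin-++ G cs ds))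

span-• : ∀ {G X} c → Span G X → Span G (c • X)
span-• {G} c (cs , X≈) = scale c cs , ≈-trans (•-cong c X≈) (lin-scale G c cs)

span-generator : ∀ G β → Span G (G β)
span-generator G β = (1ℚ , β) ∷ [] , ≋⇒≈ (λ e → sym (trans (ℚP.+-identityʳ _) (ℚP.*-identityˡ _)))

span-ΣS : ∀ {G} {A : Set} (xs : List A) (f : A → Series) → (∀ x → x ∈ xs → Span G (f x)) → Span G (ΣS xs f)
span-ΣS []       f spans = [] , ≈-refl
span-ΣS (x ∷ xs) f spans = span-⊕ (spans x (here refl)) (span-ΣS xs f (λ y y∈ → spans y (there y∈)))

span-lin : ∀ {G H} cs → (∀ β → Span H (G β)) → Span H (lin G cs)
span-lin []             spans = [] , ≈-refl
span-lin ((q , β) ∷ cs) spans = span-⊕ (span-• q (spans β)) (span-lin cs spans)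

span-▹ : ∀ g {G H} → (∀ β → Span H (g ▹ G β)) → ∀ {X} → Span G X → Span H (g ▹ X)
span-▹ g {G} spans (cs , X≈) = span-≈ (≈-trans (▹-cong g X≈) (▹-lin g G cs)) (span-lin cs spans)

span-zeros : ∀ {G} → (∀ {X} → Span G X → Span G (0 ▹ X)) → ∀ j {X} → Span G X → Span G (zeros j ▹* X)
span-zeros 0▹-closed zero    span = span
span-zeros 0▹-closed (suc j) span = 0▹-closed (span-zeros 0▹-closed j span)

Span⇒Span₁ : ∀ {G X} → Span G X → Span₁ G X
Span⇒Span₁ {G} (cs , X≈) = 0ℚ , cs , ≈-trans X≈
  (≋⇒≈ (λ e → sym (trans (cong (_+ℚ lin G cs e) (ℚP.*-zeroˡ (1S e))) (ℚP.+-identityˡ (lin G cs e)))))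

span₁-≈ : ∀ {G X Y} → X ≈ Y → Span₁ G Y → Span₁ G X
span₁-≈ X≈Y (c₀ , cs , Y≈) = c₀ , cs , ≈-trans X≈Y Y≈

span₁-1 : ∀ {G} → Span₁ G 1S
span₁-1 = 1ℚ , [] , ≋⇒≈ (λ e → sym (trans (ℚP.+-identityʳ _) (ℚP.*-identityˡ _)))

span₁-⊕ : ∀ {G X Y} → Span₁ G X → Span₁ G Y → Span₁ G (X ⊕ Y)
span₁-⊕ {G} (c , cs , X≈) (d , ds , Y≈) = c +ℚ d , cs ++ ds , ≈-trans (⊕-cong X≈ Y≈) (≈-trans
  (≋⇒≈ (λ e → solve 5 (λ c d o x y → (c :* o :+ x) :+ (d :* o :+ y) := (c :+ d) :* o :+ (x :+ y)) refl
                       c d (1S e) (lin G cs e) (lin G ds e)))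
  (⊕-cong {(c +ℚ d) • 1S} ≈-refl (≈-sym (lin-++ G cs ds))))
  where open +-*-Solver

span₁-• : ∀ {G X} k → Span₁ G X → Span₁ G (k • X)
span₁-• {G} k (c , cs , X≈) = k *ℚ c , scale k cs , ≈-trans (•-cong k X≈) (≈-trans
  (≋⇒≈ (λ e → solve 4 (λ k c o x → k :* (c :* o :+ x) := (k :* c) :* o :+ k :* x) refl k c (1S e) (lin G cs e)))
  (⊕-cong {(k *ℚ c) • 1S} ≈-refl (lin-scale G k cs)))
  where open +-*-Solver

span₁-lin : ∀ {G H} cs → (∀ β → Span₁ H (G β)) → Span₁ H (lin G cs)
span₁-lin []             spans = 0ℚ , [] , ≋⇒≈ (λ e → sym (trans (cong (_+ℚ 0ℚ) (ℚP.*-zeroˡ (1S e))) (ℚP.+-identityˡ 0ℚ)))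
span₁-lin ((q , β) ∷ cs) spans = span₁-⊕ (span₁-• q (spans β)) (span₁-lin cs spans)

span₁-▹ : ∀ g {G H} → Span H (g ▹ 1S) → (∀ β → Span H (g ▹ G β)) → ∀ {X} → Span₁ G X → Span H (g ▹ X)
span₁-▹ g {G} span1 spans (c₀ , cs , X≈) =
  span-≈ (≈-trans (▹-cong g X≈) (▹-⊕ g (c₀ • 1S) (lin G cs)))
         (span-⊕ (span-≈ (▹-• g c₀ 1S) (span-• c₀ span1)) (span-▹ g spans (cs , ≈-refl)))

move-left : ∀ X Y Z → X ≈ Y ⊕ Z → Z ≈ X ⊕ (- 1ℚ) • Y
move-left X Y Z X≈ = ≋⇒≈ (λ e → trans
  (sym (solve 2 (λ y z → (y :+ z) :+ (:- con 1ℚ) :* y := z) refl (Y e) (Z e)))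
  (cong (λ x → x +ℚ (- 1ℚ) *ℚ Y e) (sym (≈⇒≋ X≈ e))))
  where open +-*-Solver

move-right : ∀ X Y Z → X ≈ Y ⊕ Z → Y ≈ X ⊕ (- 1ℚ) • Z
move-right X Y Z X≈ = ≋⇒≈ (λ e → trans
  (sym (solve 2 (λ y z → (y :+ z) :+ (:- con 1ℚ) :* z := y) refl (Y e) (Z e)))
  (cong (λ x → x +ℚ (- 1ℚ) *ℚ Z e) (sym (≈⇒≋ X≈ e))))
  where open +-*-Solver

M-0▹ : ∀ j t bs → 0 ▹ M ((j , t) ∷⁺ bs) ≈ M ((suc j , t) ∷⁺ bs)
M-0▹ j t bs = ≈-sym (Mseq-∷ 0 (flat ((j , t) ∷⁺ bs)))

M-suc▹ : ∀ t b bs → suc t ▹ M (b ∷⁺ bs) ≈ M ((0 , t) ∷⁺ (b ∷ bs))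
M-suc▹ t b bs = ≈-sym (Mseq-∷ (suc t) (flat (b ∷⁺ bs)))

M-suc▹1 : ∀ t → suc t ▹ 1S ≈ M ((0 , t) ∷⁺ [])
M-suc▹1 t = ≈-sym (≈-trans (Mseq-∷ (suc t) []) (▹-cong (suc t) seriesPat-[]))

span-M-0▹ : ∀ {X} → Span M X → Span M (0 ▹ X)
span-M-0▹ = span-▹ 0 (λ { ((j , t) ∷⁺ bs) → span-≈ (M-0▹ j t bs) (span-generator M ((suc j , t) ∷⁺ bs)) })

span-M-suc▹ : ∀ t {X} → Span₁ M X → Span M (suc t ▹ X)
span-M-suc▹ t = span₁-▹ (suc t) (span-≈ (M-suc▹1 t) (span-generator M ((0 , t) ∷⁺ [])))
  (λ { (b ∷⁺ bs) → span-≈ (M-suc▹ t b bs) (span-generator M ((0 , t) ∷⁺ (b ∷ bs))) })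

span-M-positive▹* : ∀ a c {X} → 0 < a → All (0 <_) c → Span₁ M X → Span M ((a ∷ c) ▹* X)
span-M-positive▹* (suc t) []      _ []            span = span-M-suc▹ t span
span-M-positive▹* (suc t) (a ∷ c) _ (a>0 ∷ c>0) span = span-M-suc▹ t (Span⇒Span₁ (span-M-positive▹* a c a>0 c>0 span))

span-M-composition : ∀ {t c X} → CompositionFrom 1 t c → Span₁ M X → Span M (c ▹* X)
span-M-composition (composition {a} {rest} a>0 rest>0 _) = span-M-positive▹* a rest a>0 rest>0

Fᵇ-in-span₁M : ∀ bs → Span₁ M (Fᵇ bs)
Fᵇ-in-span₁M []             = span₁-≈ seriesPat-[] span₁-1
Fᵇ-in-span₁M ((i , t) ∷ bs) = Span⇒Span₁ (span-≈ (Fᵇ-∷ i t bs)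
  (span-ΣS (upTo (suc i)) (λ j → ℕ→ℚ (i C j) • (zeros j ▹* ΣS (compositionsFrom 1 t) (λ c → c ▹* Fᵇ bs)))
    (λ j _ → span-• (ℕ→ℚ (i C j)) (span-zeros span-M-0▹ j
      (span-ΣS (compositionsFrom 1 t) (λ c → c ▹* Fᵇ bs)
               (λ c c∈ → span-M-composition (compositionsFrom-sound 1 t c∈) (Fᵇ-in-span₁M bs)))))))

F-in-LWCQSym : (α : LWC) → InLWCQSym (F α)
F-in-LWCQSym α = let c₀ , cs , Fᵇ≈ = Fᵇ-in-span₁M (toList α) in c₀ , cs , ≈⇒≋ (≈-trans (F≈Fᵇ α) Fᵇ≈)

span-F-0▹ : ∀ {X} → Span F X → Span F (0 ▹ X)
span-F-0▹ = span-▹ 0 F-0▹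
  where
  F-0▹ : ∀ β → Span F (0 ▹ F β)
  F-0▹ β@((j , t) ∷⁺ bs) = span-≈ (≈-trans (▹-cong 0 (F≈Fᵇ β)) (move-right _ (0 ▹ Fᵇ ((j , t) ∷ bs)) (Fᵇ ((j , t) ∷ bs)) (blockSeries-suc true j t (blocksPat bs))))
    (span-⊕ (span-≈ (≈-sym (F≈Fᵇ ((suc j , t) ∷⁺ bs))) (span-generator F ((suc j , t) ∷⁺ bs)))
            (span-• (- 1ℚ) (span-≈ (≈-sym (F≈Fᵇ β)) (span-generator F β))))

-- By onesSeries-suc, a prefix exponent g + 1 ≥ 2 is traded for a prefix exponent g,
-- one more weak one, and a leading ones block; at exponent 1 we have reached Fᵇ.
span-F-suc▹Fᵇ : ∀ t bs → Span F (suc t ▹ Fᵇ bs)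
span-F-suc▹Fᵇ = <-rec (λ t → ∀ bs → Span F (suc t ▹ Fᵇ bs)) step
  where
  step : ∀ t → (∀ {s} → s < t → ∀ bs → Span F (suc s ▹ Fᵇ bs)) → ∀ bs → Span F (suc t ▹ Fᵇ bs)
  step t smaller bs = span-≈ (≈-sym (onesSeries-zero (suc t) P (blocksPat-strict bs))) (ones t 0 (ℕP.+-identityʳ t))
    where
    P = blocksPat bs
    ones : ∀ a m → a + m ≡ t → Span F (onesSeries (suc a) m P)
    ones zero    m refl = span-≈ (≈-sym (blockSeries-0 true m P)) (span-≈ (≈-sym (F≈Fᵇ ((0 , m) ∷⁺ bs))) (span-generator F ((0 , m) ∷⁺ bs)))
    ones (suc a) m a+m≡t = span-≈ (move-left _ (suc a ▹ onesSeries 1 m P) (onesSeries (2 + a) m P) (onesSeries-suc (suc a) m P))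
      (span-⊕ (ones a (suc m) (trans (ℕP.+-suc a m) a+m≡t))
              (span-• (- 1ℚ) (span-≈ (▹-cong (suc a) (≈-sym (blockSeries-0 true m P))) (smaller a<t ((0 , m) ∷ bs)))))
      where
      a<t : a < t
      a<t = ℕP.<-≤-trans (ℕP.n<1+n a) (subst (suc a ≤_) a+m≡t (ℕP.m≤m+n (suc a) m))

span-F-suc▹ : ∀ t {X} → Span₁ F X → Span F (suc t ▹ X)
span-F-suc▹ t = span₁-▹ (suc t)
  (span-≈ (▹-cong (suc t) (≈-sym seriesPat-[])) (span-F-suc▹Fᵇ t []))
  (λ β → span-≈ (▹-cong (suc t) (F≈Fᵇ β)) (span-F-suc▹Fᵇ t (toList β)))

Mseq-flatᵇ-in-span₁F : ∀ bs → Span₁ F (Mseq (flatᵇ bs))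
Mseq-flatᵇ-in-span₁F []             = span₁-≈ seriesPat-[] span₁-1
Mseq-flatᵇ-in-span₁F ((i , t) ∷ bs) =
  Span⇒Span₁ (span-≈ unfold (span-zeros span-F-0▹ i (span-F-suc▹ t (Mseq-flatᵇ-in-span₁F bs))))
  where
  unfold : Mseq (flatᵇ ((i , t) ∷ bs)) ≈ zeros i ▹* suc t ▹ Mseq (flatᵇ bs)
  unfold = ≈-trans (≋⇒≈ (λ e → cong (λ γ → Mseq γ e) (LP.++-assoc (zeros i) (suc t ∷ []) (flatᵇ bs))))
                   (≈-trans (Mseq-++ (zeros i) (suc t ∷ flatᵇ bs)) (▹*-cong (zeros i) (Mseq-∷ (suc t) (flatᵇ bs))))

LWCQSym-in-spanF : (f : Series) → InLWCQSym f → InSpanF f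
LWCQSym-in-spanF f (c₀ , cs , f≋) =
  let d₀ , ds , ≈F = span₁-⊕ (span₁-• c₀ (span₁-1 {F})) (span₁-lin cs (λ β → Mseq-flatᵇ-in-span₁F (toList β)))
  in d₀ , ds , ≈⇒≋ (≈-trans (≋⇒≈ f≋) ≈F)

-- Linear independence

-- Δ strips a leading 0 ▹_ and annihilates g ▹_ for g ≥ 1; this makes the probes below triangular.
Δ : Series → Series
Δ X e = X (0 ∷ e) - X e

Δ^ : ℕ → Series → Series
Δ^ zero    X = X
Δ^ (suc i) X = Δ^ i (Δ X)

Δ-cong : ∀ {X Y} → X ≈ Y → Δ X ≈ Δ Y
Δ-cong (≋⇒≈ X≋Y) = ≋⇒≈ (λ e → cong₂ _-_ (X≋Y (0 ∷ e)) (X≋Y e))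

Δ-⊕ : ∀ X Y → Δ (X ⊕ Y) ≈ Δ X ⊕ Δ Y
Δ-⊕ X Y = ≋⇒≈ (λ e → solve 4 (λ a b c d → (a :+ b) :- (c :+ d) := (a :- c) :+ (b :- d)) refl
                              (X (0 ∷ e)) (Y (0 ∷ e)) (X e) (Y e))
  where open +-*-Solver

Δ-• : ∀ c X → Δ (c • X) ≈ c • Δ X
Δ-• c X = ≋⇒≈ (λ e → solve 3 (λ c a b → c :* a :- c :* b := c :* (a :- b)) refl c (X (0 ∷ e)) (X e))
  where open +-*-Solver

Δ-0▹ : ∀ X → Δ (0 ▹ X) ≈ X
Δ-0▹ X = ≋⇒≈ (λ e → solve 2 (λ x y → (x :+ y) :- y := x) refl (X e) ((0 ▹ X) e))
  where open +-*-Solver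

Δ-suc▹ : ∀ g X → Δ (suc g ▹ X) ≈ 0S
Δ-suc▹ g X = ≋⇒≈ (λ e → solve 1 (λ y → (con 0ℚ :+ y) :- y := con 0ℚ) refl ((suc g ▹ X) e))
  where open +-*-Solver

Δ-1S : Δ 1S ≈ 0S
Δ-1S = ≋⇒≈ (λ e → ℚP.+-inverseʳ (1S e))

Δ^-cong : ∀ i {X Y} → X ≈ Y → Δ^ i X ≈ Δ^ i Y
Δ^-cong zero    X≈Y = X≈Y
Δ^-cong (suc i) X≈Y = Δ^-cong i (Δ-cong X≈Y)

Δ^-⊕ : ∀ i X Y → Δ^ i (X ⊕ Y) ≈ Δ^ i X ⊕ Δ^ i Y
Δ^-⊕ zero    X Y = ≈-refl
Δ^-⊕ (suc i) X Y = ≈-trans (Δ^-cong i (Δ-⊕ X Y)) (Δ^-⊕ i (Δ X) (Δ Y))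

Δ^-• : ∀ i c X → Δ^ i (c • X) ≈ c • Δ^ i X
Δ^-• zero    c X = ≈-refl
Δ^-• (suc i) c X = ≈-trans (Δ^-cong i (Δ-• c X)) (Δ^-• i c (Δ X))

Δ^-≈0S : ∀ i {X} → X ≈ 0S → Δ^ i X ≈ 0S
Δ^-≈0S zero    X≈0 = X≈0
Δ^-≈0S (suc i) X≈0 = Δ^-≈0S i (≈-trans (Δ-cong X≈0) (≋⇒≈ (λ e → ℚP.+-inverseʳ 0ℚ)))

Δ-onesSeries : ∀ g m P → StartsStrict P → Δ (onesSeries (suc g) m P) ≈ 0S
Δ-onesSeries g zero    P st = ≈-trans (Δ-cong (onesSeries-zero (suc g) P st)) (Δ-suc▹ g (seriesPat P))
Δ-onesSeries g (suc m) P st = begin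
  Δ (onesSeries (suc g) (suc m) P)
    ≈⟨ Δ-cong (onesSeries-suc (suc g) m P) ⟩
  Δ (suc g ▹ onesSeries 1 m P ⊕ onesSeries (2 + g) m P)
    ≈⟨ Δ-⊕ (suc g ▹ onesSeries 1 m P) (onesSeries (2 + g) m P) ⟩
  Δ (suc g ▹ onesSeries 1 m P) ⊕ Δ (onesSeries (2 + g) m P)
    ≈⟨ ⊕-cong (Δ-suc▹ g (onesSeries 1 m P)) (Δ-onesSeries (suc g) m P st) ⟩
  0S ⊕ 0S
    ≈⟨ ≋⇒≈ (λ e → ℚP.+-identityˡ 0ℚ) ⟩
  0S ∎
  where open ≈-Reasoning

Δ^-blockSeries : ∀ t′ P → StartsStrict P → ∀ i k t es →
  Δ^ k (blockSeries true (i , t′) P) (suc t ∷ es) ≡ ℕ→ℚ (i C k) *ℚ blockSeries true (0 , t′) P (suc t ∷ es)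
Δ^-blockSeries t′ P st zero    zero    t es = sym (ℚP.*-identityˡ _)
Δ^-blockSeries t′ P st zero    (suc k) t es = trans
  (≈⇒≋ (Δ^-≈0S k (≈-trans (Δ-cong (blockSeries-0 true t′ P)) (Δ-onesSeries 0 t′ P st))) (suc t ∷ es))
  (sym (ℚP.*-zeroˡ (blockSeries true (0 , t′) P (suc t ∷ es))))
Δ^-blockSeries t′ P st (suc i) zero    t es = trans (≈⇒≋ (blockSeries-suc true i t′ P) (suc t ∷ es))
  (trans (cong (0ℚ +ℚ 0ℚ +ℚ_) (Δ^-blockSeries t′ P st i zero t es)) (ℚP.+-identityˡ _))
Δ^-blockSeries t′ P st (suc i) (suc k) t es = begin
  Δ^ k (Δ (Z (suc i))) (suc t ∷ es)
    ≡⟨ ≈⇒≋ (Δ^-cong k (≈-trans (Δ-cong (blockSeries-suc true i t′ P))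
                        (≈-trans (Δ-⊕ (0 ▹ Z i) (Z i)) (⊕-cong (Δ-0▹ (Z i)) ≈-refl)))) (suc t ∷ es) ⟩
  Δ^ k (Z i ⊕ Δ (Z i)) (suc t ∷ es)
    ≡⟨ ≈⇒≋ (Δ^-⊕ k (Z i) (Δ (Z i))) (suc t ∷ es) ⟩
  Δ^ k (Z i) (suc t ∷ es) +ℚ Δ^ (suc k) (Z i) (suc t ∷ es)
    ≡⟨ cong₂ _+ℚ_ (Δ^-blockSeries t′ P st i k t es) (Δ^-blockSeries t′ P st i (suc k) t es) ⟩
  ℕ→ℚ (i C k) *ℚ V +ℚ ℕ→ℚ (i C suc k) *ℚ V
    ≡⟨ ℚP.*-distribʳ-+ V (ℕ→ℚ (i C k)) (ℕ→ℚ (i C suc k)) ⟨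
  (ℕ→ℚ (i C k) +ℚ ℕ→ℚ (i C suc k)) *ℚ V
    ≡⟨ cong (_*ℚ V) (trans (sym (ℕ→ℚ-+ (i C k) (i C suc k))) (cong ℕ→ℚ (nCk+nC[k+1]≡[n+1]C[k+1] i k))) ⟩
  ℕ→ℚ (suc i C suc k) *ℚ V ∎
  where
  open ≡-Reasoning
  Z = λ i → blockSeries true (i , t′) P
  V = Z 0 (suc t ∷ es)

-- onesSeries g m P at first exponent g + k: the k extra ones are taken from the run.
residual : ℕ → ℕ → Pat → Series
residual zero    zero    P = seriesPat P
residual zero    (suc m) P = onesSeries 1 m P
residual (suc k) zero    P = 0S
residual (suc k) (suc m) P = residual k m P

if-false : ∀ {b : Bool} {x y : ℚ} → b ≡ false → (if b then x else y) ≡ y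
if-false refl = refl

if-true : ∀ {b : Bool} {x y : ℚ} → b ≡ true → (if b then x else y) ≡ x
if-true refl = refl

▹-at-other : ∀ g X a es → ¬ a ≡ g → ¬ a ≡ 0 → (g ▹ X) (a ∷ es) ≡ 0ℚ
▹-at-other g X a es a≢g a≢0 =
  trans (cong₂ _+ℚ_ (if-false (≢⇒≡ᵇ-false a≢g)) (if-false (≢⇒≡ᵇ-false a≢0))) (ℚP.+-identityʳ 0ℚ)

▹-at-self : ∀ g X es → ¬ g ≡ 0 → (g ▹ X) (g ∷ es) ≡ X es
▹-at-self g X es g≢0 =
  trans (cong₂ _+ℚ_ (if-true (≡ᵇ-refl g)) (if-false (≢⇒≡ᵇ-false g≢0))) (ℚP.+-identityʳ (X es))

onesSeries-below : ∀ m g a P → StartsStrict P → 1 ≤ a → a < g → ∀ es → onesSeries g m P (a ∷ es) ≡ 0ℚ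
onesSeries-below zero    g a P st a≥1 a<g es = trans (≈⇒≋ (onesSeries-zero g P st) (a ∷ es))
  (▹-at-other g (seriesPat P) a es (ℕP.<⇒≢ a<g) (ℕP.>⇒≢ a≥1))
onesSeries-below (suc m) g a P st a≥1 a<g es = trans (≈⇒≋ (onesSeries-suc g m P) (a ∷ es))
  (trans (cong₂ _+ℚ_ (▹-at-other g (onesSeries 1 m P) a es (ℕP.<⇒≢ a<g) (ℕP.>⇒≢ a≥1))
                     (onesSeries-below m (suc g) a P st a≥1 (ℕP.m<n⇒m<1+n a<g) es))
         (ℚP.+-identityʳ 0ℚ))

onesSeries-at : ∀ m g k P → StartsStrict P → 1 ≤ g → ∀ es → onesSeries g m P (g + k ∷ es) ≡ residual k m P es
onesSeries-at zero    g zero    P st g≥1 es = trans (cong (λ a → onesSeries g 0 P (a ∷ es)) (ℕP.+-identityʳ g))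
  (trans (≈⇒≋ (onesSeries-zero g P st) (g ∷ es)) (▹-at-self g (seriesPat P) es (ℕP.>⇒≢ g≥1)))
onesSeries-at zero    g (suc k) P st g≥1 es = trans (≈⇒≋ (onesSeries-zero g P st) (g + suc k ∷ es))
  (▹-at-other g (seriesPat P) (g + suc k) es (ℕP.>⇒≢ (ℕP.m<m+n g (s≤s z≤n))) (ℕP.>⇒≢ (ℕP.≤-trans g≥1 (ℕP.m≤m+n g (suc k)))))
onesSeries-at (suc m) g zero    P st g≥1 es = trans (cong (λ a → onesSeries g (suc m) P (a ∷ es)) (ℕP.+-identityʳ g))
  (trans (≈⇒≋ (onesSeries-suc g m P) (g ∷ es))
  (trans (cong₂ _+ℚ_ (▹-at-self g (onesSeries 1 m P) es (ℕP.>⇒≢ g≥1))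
                     (onesSeries-below m (suc g) g P st g≥1 (ℕP.n<1+n g) es))
         (ℚP.+-identityʳ (onesSeries 1 m P es))))
onesSeries-at (suc m) g (suc k) P st g≥1 es = trans (≈⇒≋ (onesSeries-suc g m P) (g + suc k ∷ es))
  (trans (cong₂ _+ℚ_ (▹-at-other g (onesSeries 1 m P) (g + suc k) es
                        (ℕP.>⇒≢ (ℕP.m<m+n g (s≤s z≤n))) (ℕP.>⇒≢ (ℕP.≤-trans g≥1 (ℕP.m≤m+n g (suc k)))))
                     (trans (cong (λ a → onesSeries (suc g) m P (a ∷ es)) (ℕP.+-suc g k))
                            (onesSeries-at m (suc g) k P st (ℕP.m≤n⇒m≤1+n g≥1) es)))
         (ℚP.+-identityˡ (residual k m P es)))

probe : List (ℕ × ℕ) → Series → ℚ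
probe []             X = X []
probe ((i , t) ∷ bs) X = probe bs (λ es → Δ^ i X (suc t ∷ es))

probe-cong : ∀ bs {X Y} → X ≈ Y → probe bs X ≡ probe bs Y
probe-cong []             X≈Y = ≈⇒≋ X≈Y []
probe-cong ((i , t) ∷ bs) X≈Y = probe-cong bs (≋⇒≈ (λ es → ≈⇒≋ (Δ^-cong i X≈Y) (suc t ∷ es)))

probe-⊕ : ∀ bs X Y → probe bs (X ⊕ Y) ≡ probe bs X +ℚ probe bs Y
probe-⊕ []             X Y = refl
probe-⊕ ((i , t) ∷ bs) X Y = trans (probe-cong bs (≋⇒≈ (λ es → ≈⇒≋ (Δ^-⊕ i X Y) (suc t ∷ es)))) (probe-⊕ bs _ _)

probe-• : ∀ bs c X → probe bs (c • X) ≡ c *ℚ probe bs X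
probe-• []             c X = refl
probe-• ((i , t) ∷ bs) c X = trans (probe-cong bs (≋⇒≈ (λ es → ≈⇒≋ (Δ^-• i c X) (suc t ∷ es)))) (probe-• bs c _)

probe-≈0S : ∀ bs {X} → X ≈ 0S → probe bs X ≡ 0ℚ
probe-≈0S []             X≈0 = ≈⇒≋ X≈0 []
probe-≈0S ((i , t) ∷ bs) X≈0 = probe-≈0S bs (≋⇒≈ (λ es → ≈⇒≋ (Δ^-≈0S i X≈0) (suc t ∷ es)))

probe-lin : ∀ bs G cs → probe bs (lin G cs) ≡ Σq cs (λ (q , β) → q *ℚ probe bs (G β))
probe-lin bs G []             = probe-≈0S bs ≈-refl
probe-lin bs G ((q , β) ∷ cs) = trans (probe-⊕ bs _ _) (cong₂ _+ℚ_ (probe-• bs q (G β)) (probe-lin bs G cs))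

mutual
  triangle : List (ℕ × ℕ) → List (ℕ × ℕ) → ℕ
  triangle []             []               = 1
  triangle []             (_ ∷ _)          = 0
  triangle (_ ∷ _)        []               = 0
  triangle ((i , t) ∷ as) ((i′ , t′) ∷ bs) = (i′ C i) ℕ.* triangleOnes t t′ as bs

  -- compares a run of t + 1 ones against a run of t′ + 1 ones, the surplus of which starts a new block
  triangleOnes : ℕ → ℕ → List (ℕ × ℕ) → List (ℕ × ℕ) → ℕ
  triangleOnes zero    zero    as bs = triangle as bs
  triangleOnes zero    (suc m) as bs = triangle as ((0 , m) ∷ bs)
  triangleOnes (suc k) zero    as bs = 0
  triangleOnes (suc k) (suc m) as bs = triangleOnes k m as bs

Fᵇ-at-[] : ∀ b bs → Fᵇ (b ∷ bs) [] ≡ 0ℚ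
Fᵇ-at-[] (zero  , t) bs = refl
Fᵇ-at-[] (suc i , t) bs = refl

mutual
  probe-Fᵇ : ∀ as bs → probe as (Fᵇ bs) ≡ ℕ→ℚ (triangle as bs)
  probe-Fᵇ []             []               = ≈⇒≋ seriesPat-[] []
  probe-Fᵇ []             (b ∷ bs)         = Fᵇ-at-[] b bs
  probe-Fᵇ ((i , t) ∷ as) []               = probe-≈0S as (≋⇒≈ (Δ^-1-at i))
    where
    Δ^-1-at : ∀ i es → Δ^ i (Fᵇ []) (suc t ∷ es) ≡ 0ℚ
    Δ^-1-at zero    es = ≈⇒≋ seriesPat-[] (suc t ∷ es)
    Δ^-1-at (suc i) es = ≈⇒≋ (Δ^-≈0S i (≈-trans (Δ-cong seriesPat-[]) Δ-1S)) (suc t ∷ es)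
  probe-Fᵇ ((i , t) ∷ as) ((i′ , t′) ∷ bs) = begin
    probe as (λ es → Δ^ i (blockSeries true (i′ , t′) P) (suc t ∷ es))
      ≡⟨ probe-cong as (≋⇒≈ (λ es → Δ^-blockSeries t′ P st i′ i t es)) ⟩
    probe as (ℕ→ℚ (i′ C i) • (λ es → blockSeries true (0 , t′) P (suc t ∷ es)))
      ≡⟨ probe-• as (ℕ→ℚ (i′ C i)) _ ⟩
    ℕ→ℚ (i′ C i) *ℚ probe as (λ es → blockSeries true (0 , t′) P (suc t ∷ es))
      ≡⟨ cong (ℕ→ℚ (i′ C i) *ℚ_) (probe-cong as (≋⇒≈ (λ es →
           trans (≈⇒≋ (blockSeries-0 true t′ P) (suc t ∷ es)) (onesSeries-at t′ 1 t P st (s≤s z≤n) es)))) ⟩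
    ℕ→ℚ (i′ C i) *ℚ probe as (residual t t′ P)
      ≡⟨ cong (ℕ→ℚ (i′ C i) *ℚ_) (probe-residual t t′ as bs) ⟩
    ℕ→ℚ (i′ C i) *ℚ ℕ→ℚ (triangleOnes t t′ as bs)
      ≡⟨ ℕ→ℚ-* (i′ C i) (triangleOnes t t′ as bs) ⟨
    ℕ→ℚ (triangle ((i , t) ∷ as) ((i′ , t′) ∷ bs)) ∎
    where
    open ≡-Reasoning
    P = blocksPat bs
    st = blocksPat-strict bs

  probe-residual : ∀ k m as bs → probe as (residual k m (blocksPat bs)) ≡ ℕ→ℚ (triangleOnes k m as bs)
  probe-residual zero    zero    as bs = probe-Fᵇ as bs
  probe-residual zero    (suc m) as bs = trans (probe-cong as (≈-sym (blockSeries-0 true m (blocksPat bs)))) (probe-Fᵇ as ((0 , m) ∷ bs))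
  probe-residual (suc k) zero    as bs = probe-≈0S as ≈-refl
  probe-residual (suc k) (suc m) as bs = probe-residual k m as bs

size : List (ℕ × ℕ) → ℕ
size []             = 0
size ((i , t) ∷ bs) = i + (t + size bs)

C≢0⇒≤ : ∀ n k → ¬ n C k ≡ 0 → k ≤ n
C≢0⇒≤ n k nCk≢0 with ℕP.≤-<-connex k n
... | inj₁ k≤n = k≤n
... | inj₂ n<k = ⊥-elim (nCk≢0 (k>n⇒nCk≡0 n<k))

*≢0⇒≢0 : ∀ m n → ¬ m ℕ.* n ≡ 0 → ¬ m ≡ 0 × ¬ n ≡ 0
*≢0⇒≢0 m n mn≢0 = (λ { refl → mn≢0 refl }) , (λ { refl → mn≢0 (ℕP.*-zeroʳ m) })

mutual
  triangle-upper : ∀ as bs → ¬ triangle as bs ≡ 0 → as ≡ bs ⊎ size as < size bs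
  triangle-upper []             []               _   = inj₁ refl
  triangle-upper []             (_ ∷ _)          ≢0 = ⊥-elim (≢0 refl)
  triangle-upper (_ ∷ _)        []               ≢0 = ⊥-elim (≢0 refl)
  triangle-upper ((i , t) ∷ as) ((i′ , t′) ∷ bs) ≢0
    with *≢0⇒≢0 (i′ C i) (triangleOnes t t′ as bs) ≢0
  ... | C≢0 , ones≢0 with C≢0⇒≤ i′ i C≢0 | triangleOnes-upper t t′ as bs ones≢0
  ...   | i≤i′ | inj₂ smaller = inj₂ (ℕP.+-mono-≤-< i≤i′ smaller)
  ...   | i≤i′ | inj₁ (refl , inj₂ smaller) = inj₂ (ℕP.+-mono-≤-< i≤i′ (ℕP.+-monoʳ-< t smaller))
  ...   | i≤i′ | inj₁ (refl , inj₁ refl) with ℕP.m≤n⇒m<n∨m≡n i≤i′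
  ...     | inj₁ i<i′ = inj₂ (ℕP.+-monoˡ-< (t + size as) i<i′)
  ...     | inj₂ refl = inj₁ refl

  triangleOnes-upper : ∀ k m as bs → ¬ triangleOnes k m as bs ≡ 0 →
                       (k ≡ m × (as ≡ bs ⊎ size as < size bs)) ⊎ k + size as < m + size bs
  triangleOnes-upper zero    zero    as bs ≢0 = inj₁ (refl , triangle-upper as bs ≢0)
  triangleOnes-upper zero    (suc m) as bs ≢0 with triangle-upper as ((0 , m) ∷ bs) ≢0
  ... | inj₁ refl    = inj₂ (ℕP.n<1+n _)
  ... | inj₂ smaller = inj₂ (ℕP.<-trans smaller (ℕP.n<1+n _))
  triangleOnes-upper (suc k) zero    as bs ≢0 = ⊥-elim (≢0 refl)
  triangleOnes-upper (suc k) (suc m) as bs ≢0 with triangleOnes-upper k m as bs ≢0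
  ... | inj₁ (refl , r) = inj₁ (refl , r)
  ... | inj₂ smaller    = inj₂ (s≤s smaller)

triangleOnes-diagonal : ∀ t as → triangleOnes t t as as ≡ triangle as as
triangleOnes-diagonal zero    as = refl
triangleOnes-diagonal (suc t) as = triangleOnes-diagonal t as

triangle-diagonal : ∀ as → triangle as as ≡ 1
triangle-diagonal []             = refl
triangle-diagonal ((i , t) ∷ as) rewrite nCn≡1 i | triangleOnes-diagonal t as | triangle-diagonal as = refl

Σq-zero : {A : Set} (xs : List A) (f : A → ℚ) → (∀ x → x ∈ xs → f x ≡ 0ℚ) → Σq xs f ≡ 0ℚ
Σq-zero []       f zeros = refl
Σq-zero (x ∷ xs) f zeros =
  trans (cong₂ _+ℚ_ (zeros x (here refl)) (Σq-zero xs f (λ y y∈ → zeros y (there y∈)))) (ℚP.+-identityʳ 0ℚ)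

Σq-single : ∀ cs (f : ℚ → LWC → ℚ) {q α} → Unique (map proj₂ cs) → (q , α) ∈ cs →
            (∀ {q′ β} → (q′ , β) ∈ cs → ¬ β ≡ α → f q′ β ≡ 0ℚ) → Σq cs (λ (q , β) → f q β) ≡ f q α
Σq-single ((q , α) ∷ cs) f (α∉cs ∷ _) (here refl) others =
  trans (cong (f q α +ℚ_) (Σq-zero cs _ (λ (q′ , β) β∈ → others (there β∈) (λ β≡α → All.lookup α∉cs (∈P.∈-map⁺ proj₂ β∈) (sym β≡α)))))
        (ℚP.+-identityʳ _)
Σq-single ((q₀ , β₀) ∷ cs) f (β₀∉cs ∷ u) (there α∈) others =
  trans (cong₂ _+ℚ_ (others (here refl) (λ β₀≡α → All.lookup β₀∉cs (∈P.∈-map⁺ proj₂ α∈) β₀≡α))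
                    (Σq-single cs f u α∈ (λ β∈ → others (there β∈))))
        (ℚP.+-identityˡ _)

toList-injective : ∀ {α β : LWC} → toList α ≡ toList β → α ≡ β
toList-injective {_ ∷⁺ _} {_ ∷⁺ _} = ∷→∷⁺

probeF : ∀ as β → probe as (F β) ≡ ℕ→ℚ (triangle as (toList β))
probeF as β = trans (probe-cong as (F≈Fᵇ β)) (probe-Fᵇ as (toList β))

term-at : List (ℕ × ℕ) → ℚ → LWC → ℚ
term-at as q β = q *ℚ ℕ→ℚ (triangle as (toList β))

probe-relation : ∀ c₀ cs → c₀ • 1S ⊕ lin F cs ≈ 0S →
                 ∀ as → c₀ *ℚ ℕ→ℚ (triangle as []) +ℚ Σq cs (λ (q , β) → term-at as q β) ≡ 0ℚ
probe-relation c₀ cs relation as = begin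
  c₀ *ℚ ℕ→ℚ (triangle as []) +ℚ Σq cs (λ (q , β) → term-at as q β)
    ≡⟨ cong₂ _+ℚ_ (trans (probe-• as c₀ 1S) (cong (c₀ *ℚ_) (trans (probe-cong as (≈-sym seriesPat-[])) (probe-Fᵇ as []))))
                  (trans (probe-lin as F cs) (Σq-cong cs (λ (q , β) → cong (q *ℚ_) (probeF as β)))) ⟨
  probe as (c₀ • 1S) +ℚ probe as (lin F cs)
    ≡⟨ probe-⊕ as (c₀ • 1S) (lin F cs) ⟨
  probe as (c₀ • 1S ⊕ lin F cs)
    ≡⟨ probe-≈0S as relation ⟩
  0ℚ ∎
  where open ≡-Reasoning

VanishFrom : List (ℚ × LWC) → ℕ → Set
VanishFrom cs B = ∀ {q β} → (q , β) ∈ cs → B ≤ size (toList β) → q ≡ 0ℚ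

totalSize : List (ℚ × LWC) → ℕ
totalSize []             = 0
totalSize ((_ , β) ∷ cs) = size (toList β) + totalSize cs

size≤totalSize : ∀ cs {q β} → (q , β) ∈ cs → size (toList β) ≤ totalSize cs
size≤totalSize ((_ , β) ∷ cs) (here refl) = ℕP.m≤m+n _ _
size≤totalSize ((_ , β) ∷ cs) (there β∈) = ℕP.≤-trans (size≤totalSize cs β∈) (ℕP.m≤n+m _ _)

module Vanishing (cs : List (ℚ × LWC)) (unique : Unique (map proj₂ cs))
                 (probed : ∀ α → Σq cs (λ (q , β) → term-at (toList α) q β) ≡ 0ℚ) where

  -- Probing with α of size B sees the coefficient of α, and otherwise only generators of larger size.
  vanish-step : ∀ B → VanishFrom cs (suc B) → VanishFrom cs B
  vanish-step B larger {q} {α} α∈ B≤ with ℕP.m≤n⇒m<n∨m≡n B≤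
  ... | inj₁ B< = larger α∈ B<
  ... | inj₂ refl = begin
    q                                          ≡⟨ ℚP.*-identityʳ q ⟨
    q *ℚ 1ℚ                                    ≡⟨ cong (λ n → q *ℚ ℕ→ℚ n) (triangle-diagonal (toList α)) ⟨
    term-at (toList α) q α                     ≡⟨ Σq-single cs (term-at (toList α)) unique α∈ others ⟨
    Σq cs (λ (q , β) → term-at (toList α) q β) ≡⟨ probed α ⟩
    0ℚ                                         ∎
    where
    open ≡-Reasoning
    others : ∀ {q′ β} → (q′ , β) ∈ cs → ¬ β ≡ α → term-at (toList α) q′ β ≡ 0ℚ
    others {q′} {β} β∈ β≢α with triangle (toList α) (toList β) ℕ.≟ 0
    ... | yes ≡0 = trans (cong (λ n → q′ *ℚ ℕ→ℚ n) ≡0) (ℚP.*-zeroʳ q′)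
    ... | no ≢0 with triangle-upper (toList α) (toList β) ≢0
    ...   | inj₁ α≡β = ⊥-elim (β≢α (sym (toList-injective α≡β)))
    ...   | inj₂ α<β = trans (cong (_*ℚ ℕ→ℚ (triangle (toList α) (toList β))) (larger β∈ α<β))
                             (ℚP.*-zeroˡ (ℕ→ℚ (triangle (toList α) (toList β))))

  vanish : ∀ n B → B + n ≡ suc (totalSize cs) → VanishFrom cs B
  vanish zero    B B≡ β∈ B≤ = ⊥-elim (ℕP.<⇒≱ (subst (totalSize cs <_) (trans (sym B≡) (ℕP.+-identityʳ B)) ℕP.≤-refl)
                                            (ℕP.≤-trans B≤ (size≤totalSize cs β∈)))
  vanish (suc n) B B≡ = vanish-step B (vanish n (suc B) (trans (sym (ℕP.+-suc B n)) B≡))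

F-independent : (c₀ : ℚ) (cs : List (ℚ × LWC)) → Unique (map proj₂ cs) →
                c₀ • 1S ⊕ lin F cs ≋ 0S → (c₀ ≡ 0ℚ) × All (λ cα → proj₁ cα ≡ 0ℚ) cs
F-independent c₀ cs unique relation =
  c₀≡0 , All.tabulate (λ β∈ → Vanishing.vanish cs unique probed (suc (totalSize cs)) 0 refl β∈ z≤n)
  where
  probed₀ : ∀ as → c₀ *ℚ ℕ→ℚ (triangle as []) +ℚ Σq cs (λ (q , β) → term-at as q β) ≡ 0ℚ
  probed₀ = probe-relation c₀ cs (≋⇒≈ relation)
  -- the empty probe reads the constant term; every other probe kills 1
  c₀≡0 : c₀ ≡ 0ℚ
  c₀≡0 = trans (sym (ℚP.*-identityʳ c₀)) (trans (sym (ℚP.+-identityʳ (c₀ *ℚ 1ℚ)))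
    (trans (cong (c₀ *ℚ 1ℚ +ℚ_) (sym (Σq-zero cs (λ (q , β) → term-at [] q β) (λ { (q , _ ∷⁺ _) _ → ℚP.*-zeroʳ q })))) (probed₀ [])))
  probed : ∀ α → Σq cs (λ (q , β) → term-at (toList α) q β) ≡ 0ℚ
  probed (b ∷⁺ bs) = trans (sym (ℚP.+-identityˡ _))
    (trans (cong (_+ℚ Σq cs (λ (q , β) → term-at (b ∷ bs) q β)) (sym (ℚP.*-zeroʳ c₀))) (probed₀ (b ∷ bs)))

theorem4p3 :
  -- (1) expansion  F_α = Σ_{β ⪯ α} c_{α,β} M_β, the sum running over a
  --     duplicate-free complete list of the decompositions (0^{j_p}, β_p) of β ⪯ α
  ((α : LWC) (ds : List Decomp) → Unique ds → (∀ d → (d ∈ ds) ⇔ ValidDecomp α d) →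
    F α ≋ ΣS ds (λ d → cOf α d • Mseq (βOf d)))
  -- (2) c_{α,α} = 1
  × ((α : LWC) (d : Decomp) → ValidDecomp α d → βOf d ≡ flat α → cOf α d ≡ 1ℚ)
  -- (3) {1} ∪ {F_α} is a ℚ-basis of LWCQSym: each F_α lies in LWCQSym,
  --     they span LWCQSym, and they are linearly independent
  × ((α : LWC) → InLWCQSym (F α))
  × ((f : Series) → InLWCQSym f → InSpanF f)
  × ((c₀ : ℚ) (cs : List (ℚ × LWC)) → Unique (map proj₂ cs) →
      c₀ • 1S ⊕ lin F cs ≋ 0S → (c₀ ≡ 0ℚ) × All (λ cα → proj₁ cα ≡ 0ℚ) cs)
theorem4p3 = F-expansion , (λ α → cOfᵇ-diagonal (toList α)) , F-in-LWCQSym , LWCQSym-in-spanF , F-independent
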